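{- Let $n\ge 3$ be odd and let $G=\langle A,\beta\mid \beta^2=\alpha,\ \beta a\beta^{ -1}=f(a)\ \text{for all } a\in A\rangle$ be a finite non-abelian group of order $2n$, where $A$ is an abelian subgroup of index $2$, $\alpha\in A$, and $f$ is an automorphism of $A$ of order $2$ with $f(\alpha)=\alpha$. Let $X\subseteq A\setminus\{e\}$ and $Y\subseteq A$. Then the Cayley graph $\Gamma=\mathrm{Cay}(G,X\cup Y\beta)$ is a DSRG with parameters $(2n,n-1,\frac{n-1}{2},\frac{n-3}{2},\frac{n-1}{2})$ if and only if: (i) $|X|=|Y|=\frac{n-1}{2}$; (ii) $X\cap f(X)=\emptyset$ and $X\cup f(X)=A\setminus\{e\}$; (iii) $\alpha=e$; (iv) $\overline{X}f(\overline{X})=\overline{Y}f(\overline{Y})$.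
   Context: $e$ denotes the identity. For a finite group $H$ and $S\subseteq H\setminus\{e\}$, $\mathrm{Cay}(H,S)$ is the directed graph with vertex set $H$ and an arc from $x$ to $y$ iff $yx^{ -1}\in S$. $Y\beta=\{y\beta:y\in Y\}$, $f(X)=\{f(x):x\in X\}$. A DSRG with parameters $(N,k,\mu,\lambda,t)$ is a $k$-regular loopless directed graph on $N$ vertices such that every vertex $x$ has exactly $t$ vertices $z$ with $x\to z$ and $z\to x$, and for vertices $x\ne y$ the number of $z$ with $x\to z\to y$ is $\lambda$ if $x\to y$ and $\mu$ otherwise. For $X\subseteq A$, $\overline{X}=\sum_{x\in X}x$ in the group algebra $\mathbb{C}A$, and $f$ is extended linearly to $\mathbb{C}A$; products are taken in $\mathbb{C}A$. -}

module Defs where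

open import Level using (0ℓ)
open import Data.Nat using (ℕ; zero; suc; _+_; _*_)
open import Data.Bool using (Bool; true; false; if_then_else_; _∧_)
open import Data.List using (List; []; _∷_; map; _++_)
open import Data.Nat.ListAction using (sum)
open import Data.Product using (_×_; _,_; ∃)
open import Relation.Nullary using (¬_; does)
open import Relation.Binary.Definitions using (DecidableEquality)
open import Relation.Binary.PropositionalEquality using (_≡_)
open import Algebra.Bundles using (AbelianGroup)

count : {V : Set} → (V → Bool) → List V → ℕ
count p [] = zero
count p (x ∷ xs) = if p x then suc (count p xs) else count p xs

-- Directed strongly regular graph with parameters (N,k,μ,λ,t) on the vertex
-- set enumerated (without repetition) by vs, with arc relation arc.
IsDSRG : {V : Set} → List V → (V → V → Bool) → ℕ → ℕ → ℕ → ℕ → ℕ → Set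
IsDSRG {V} vs arc N k μ lam t =
  (count (λ _ → true) vs ≡ N)
  × (∀ x → arc x x ≡ false)
  × (∀ x → count (λ z → arc x z) vs ≡ k)
  × (∀ x → count (λ z → arc z x) vs ≡ k)
  × (∀ x → count (λ z → arc x z ∧ arc z x) vs ≡ t)
  × (∀ x y → ¬ (x ≡ y) →
       count (λ z → arc x z ∧ arc z y) vs ≡ (if arc x y then lam else μ))

-- The group G = ⟨A, β | β² = α, β a β⁻¹ = f(a)⟩ realised concretely:
-- the pair (a , false) stands for a, and (a , true) stands for aβ.
module Construction (A : AbelianGroup 0ℓ 0ℓ) (f : AbelianGroup.Carrier A → AbelianGroup.Carrier A)
                    (α : AbelianGroup.Carrier A) where
  open AbelianGroup A

  G : Set
  G = Carrier × Bool

  -- (a β^i)(b β^j) = a f^i(b) β^(i+j), with β² = α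
  _·_ : G → G → G
  (a , false) · (b , j) = (a ∙ b , j)
  (a , true) · (b , false) = (a ∙ f b , true)
  (a , true) · (b , true) = ((a ∙ f b) ∙ α , false)

  -- (aβ)⁻¹ = β⁻¹ a⁻¹ = α⁻¹ f(a⁻¹) β
  inv : G → G
  inv (a , false) = (a ⁻¹ , false)
  inv (a , true) = (α ⁻¹ ∙ f (a ⁻¹) , true)

  gElems : List Carrier → List G
  gElems es = map (λ a → (a , false)) es ++ map (λ a → (a , true)) es

  conn : (Carrier → Bool) → (Carrier → Bool) → G → Bool
  conn X Y (a , false) = X a
  conn X Y (a , true) = Y a

  cayArc : (G → Bool) → G → G → Bool
  cayArc S x y = S (y · inv x)

  InImage : (Carrier → Bool) → Carrier → Set
  InImage X a = ∃ λ x → (X x ≡ true) × (f x ≡ a)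

  -- elements of the group semiring ℕA ⊆ ℂA, as coefficient functions
  GA : Set
  GA = Carrier → ℕ

  bar : (Carrier → Bool) → GA
  bar X a = if X a then 1 else 0

  mulGA : List Carrier → GA → GA → GA
  mulGA es u v a = sum (map (λ b → u b * v (b ⁻¹ ∙ a)) es)

  fGA : List Carrier → DecidableEquality Carrier → GA → GA
  fGA es _≟_ u a = sum (map (λ b → if does (f b ≟ a) then u b else 0) es)

module Submission where

-- Let s be the indicator of S = X ∪ Yβ in ℤG and μ = (n - 1)/2. Counting 2-paths, Cay(G, S) is a
-- DSRG with t = μ and λ = μ - 1 exactly when |S| = 2μ and s² + s = μ G. On the cosets A and Aβ
-- this reads, in ℤA,
--   E₁ : X² + α f(Y) Y + X = μ Ā   and   E₂ : f(X) Y + Y X + Y = μ Ā.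
-- Augmentation gives |X| = |Y| = μ. As f fixes α, applying f to E₁ gives X² + X = f(X)² + f(X),
-- and together with E₂ this makes V = X + f(X) + e - Ā satisfy V³ = V, with augmentation 0.
-- Such a V vanishes: P = V V† is self-adjoint, and the coefficient at e of the self-adjoint
-- idempotent P² is forced into {0, 1}. So X + f(X) + e = Ā, which is (ii) and forces α = e, and
-- E₁ turns into (iv). Conversely (i)-(iv) give back E₁ and E₂.

open import Level using (0ℓ)
open import Data.Bool using (Bool; false)
open import Data.Nat using (ℕ)
import Data.Nat as Nat
open import Data.List using (List; length)
open import Data.List.Membership.Propositional using (_∈_)
open import Data.List.Relation.Unary.Unique.Propositional using (Unique)
open import Relation.Binary.Definitions using (DecidableEquality)
open import Relation.Binary.PropositionalEquality using (_≡_)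
open import Algebra.Bundles using (AbelianGroup)
open import Algebra.Structures using (IsGroup)
open import Algebra.Morphism.Structures using (IsGroupHomomorphism)

module ListSum where

  open import Data.Integer using (ℤ; +_; _+_; _*_; -_; _-_; 0ℤ; 1ℤ)
  import Data.Integer.Properties as ℤP
  open import Data.Nat using (ℕ; suc)
  open import Data.Nat.ListAction using (sum)
  open import Data.Bool using (Bool; true; false; _∧_; if_then_else_)
  open import Data.List using (List; []; _∷_; map; _++_; length)
  open import Relation.Binary.PropositionalEquality
  open import Data.Integer.Tactic.RingSolver using (solve-∀)
  open import Defs using (count)

  ∑ : {T : Set} → List T → (T → ℤ) → ℤ
  ∑ [] g = 0ℤ
  ∑ (x ∷ xs) g = g x + ∑ xs g

  module _ {T : Set} where

    ∑-cong : (L : List T) {g h : T → ℤ} → (∀ x → g x ≡ h x) → ∑ L g ≡ ∑ L h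
    ∑-cong [] e = refl
    ∑-cong (x ∷ L) e = cong₂ _+_ (e x) (∑-cong L e)

    ∑-+ : (L : List T) (g h : T → ℤ) → ∑ L (λ x → g x + h x) ≡ ∑ L g + ∑ L h
    ∑-+ [] g h = refl
    ∑-+ (x ∷ L) g h rewrite ∑-+ L g h = interchange (g x) (h x) (∑ L g) (∑ L h)
      where
      interchange : ∀ a b c d → a + b + (c + d) ≡ a + c + (b + d)
      interchange = solve-∀

    ∑-*ˡ : (L : List T) (k : ℤ) (g : T → ℤ) → ∑ L (λ x → k * g x) ≡ k * ∑ L g
    ∑-*ˡ [] k g = sym (ℤP.*-zeroʳ k)
    ∑-*ˡ (x ∷ L) k g rewrite ∑-*ˡ L k g = sym (ℤP.*-distribˡ-+ k (g x) (∑ L g))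

    ∑-*ʳ : (L : List T) (k : ℤ) (g : T → ℤ) → ∑ L (λ x → g x * k) ≡ ∑ L g * k
    ∑-*ʳ L k g = trans (∑-cong L (λ x → ℤP.*-comm (g x) k)) (trans (∑-*ˡ L k g) (ℤP.*-comm k _))

    ∑-zero : (L : List T) → ∑ L (λ _ → 0ℤ) ≡ 0ℤ
    ∑-zero [] = refl
    ∑-zero (x ∷ L) = trans (ℤP.+-identityˡ _) (∑-zero L)

    ∑-neg : (L : List T) (g : T → ℤ) → ∑ L (λ x → - g x) ≡ - ∑ L g
    ∑-neg [] g = refl
    ∑-neg (x ∷ L) g rewrite ∑-neg L g = sym (ℤP.neg-distrib-+ (g x) (∑ L g))

    ∑-minus : (L : List T) (g h : T → ℤ) → ∑ L (λ x → g x - h x) ≡ ∑ L g - ∑ L h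
    ∑-minus L g h = trans (∑-+ L g (λ x → - h x)) (cong (λ z → ∑ L g + z) (∑-neg L h))

    ∑-++ : (L M : List T) (g : T → ℤ) → ∑ (L ++ M) g ≡ ∑ L g + ∑ M g
    ∑-++ [] M g = sym (ℤP.+-identityˡ _)
    ∑-++ (x ∷ L) M g rewrite ∑-++ L M g = sym (ℤP.+-assoc (g x) _ _)

  module _ {T U : Set} where

    ∑-map : (L : List T) (m : T → U) (g : U → ℤ) → ∑ (map m L) g ≡ ∑ L (λ x → g (m x))
    ∑-map [] m g = refl
    ∑-map (x ∷ L) m g = cong (λ z → g (m x) + z) (∑-map L m g)

    ∑-swap : (L : List T) (M : List U) (h : T → U → ℤ) →
             ∑ L (λ x → ∑ M (h x)) ≡ ∑ M (λ y → ∑ L (λ x → h x y))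
    ∑-swap [] M h = sym (∑-zero M)
    ∑-swap (x ∷ L) M h rewrite ∑-swap L M h = sym (∑-+ M (h x) (λ y → ∑ L (λ x → h x y)))

  ι : Bool → ℤ
  ι true = 1ℤ
  ι false = 0ℤ

  ι-∧ : ∀ a b → ι (a ∧ b) ≡ ι a * ι b
  ι-∧ true true = refl
  ι-∧ true false = refl
  ι-∧ false b = refl

  ι-if : ∀ b k → + (if b then k else 0) ≡ ι b * + k
  ι-if true k = sym (ℤP.*-identityˡ (+ k))
  ι-if false k = refl

  count≡∑ι : {T : Set} (p : T → Bool) (L : List T) → + count p L ≡ ∑ L (λ x → ι (p x))
  count≡∑ι p [] = refl
  count≡∑ι p (x ∷ L) with p x
  ... | true = trans (ℤP.pos-+ 1 (count p L)) (cong (λ z → 1ℤ + z) (count≡∑ι p L))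
  ... | false = trans (count≡∑ι p L) (sym (ℤP.+-identityˡ _))

  count-true : {T : Set} (L : List T) → count (λ _ → true) L ≡ length L
  count-true [] = refl
  count-true (x ∷ L) = cong suc (count-true L)

  pos-sum-map : {T : Set} (g : T → ℕ) (L : List T) → + sum (map g L) ≡ ∑ L (λ x → + g x)
  pos-sum-map g [] = refl
  pos-sum-map g (x ∷ L) = trans (ℤP.pos-+ (g x) _) (cong (λ z → + g x + z) (pos-sum-map g L))

module FiniteSum {T : Set} (_≟_ : DecidableEquality T) (L : List T)
                 (uniq : Unique L) (complete : ∀ x → x ∈ L) where

  open import Data.Integer using (ℤ; _+_; _*_; 0ℤ; 1ℤ; _≤_)
  import Data.Integer.Properties as ℤP
  open import Data.List using (List; []; _∷_)
  open import Data.List.Membership.Propositional using (_∈_)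
  open import Data.List.Relation.Unary.Any using (here; there)
  open import Data.List.Relation.Unary.All as All using (All; []; _∷_)
  open import Data.List.Relation.Unary.AllPairs using (_∷_)
  open import Data.List.Relation.Unary.Unique.Propositional using (Unique)
  open import Relation.Nullary using (¬_; yes; no; does)
  open import Relation.Binary.Definitions using (DecidableEquality)
  open import Relation.Binary.PropositionalEquality
  open import Data.Empty using (⊥-elim)
  open ListSum

  δ : T → T → ℤ
  δ a b = ι (does (a ≟ b))

  Σ : (T → ℤ) → ℤ
  Σ = ∑ L

  δ-refl : ∀ a → δ a a ≡ 1ℤ
  δ-refl a with a ≟ a
  ... | yes _ = refl
  ... | no a≢a = ⊥-elim (a≢a refl)

  δ-≢ : ∀ {a b} → ¬ a ≡ b → δ a b ≡ 0ℤ
  δ-≢ {a} {b} a≢b with a ≟ b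
  ... | yes a≡b = ⊥-elim (a≢b a≡b)
  ... | no _ = refl

  δ-sym : ∀ a b → δ a b ≡ δ b a
  δ-sym a b with a ≟ b | b ≟ a
  ... | yes _ | yes _ = refl
  ... | no _ | no _ = refl
  ... | yes p | no q = ⊥-elim (q (sym p))
  ... | no p | yes q = ⊥-elim (p (sym q))

  private
    ∑-δ-outside : (c : T) (g : T → ℤ) (M : List T) → All (c ≢_) M → ∑ M (λ b → δ b c * g b) ≡ 0ℤ
    ∑-δ-outside c g [] _ = refl
    ∑-δ-outside c g (x ∷ M) (c≢x ∷ c∉M)
      rewrite δ-≢ {x} {c} (λ x≡c → c≢x (sym x≡c)) | ∑-δ-outside c g M c∉M = refl

    ∑-δ-inside : (c : T) (g : T → ℤ) (M : List T) → Unique M → c ∈ M → ∑ M (λ b → δ b c * g b) ≡ g c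
    ∑-δ-inside c g (x ∷ M) (c∉M ∷ _) (here refl) rewrite δ-refl c | ∑-δ-outside c g M c∉M =
      trans (ℤP.+-identityʳ _) (ℤP.*-identityˡ (g c))
    ∑-δ-inside c g (x ∷ M) (x∉M ∷ u) (there c∈M)
      rewrite δ-≢ {x} {c} (All.lookup x∉M c∈M) | ∑-δ-inside c g M u c∈M = ℤP.+-identityˡ (g c)

  Σ-δˡ : (c : T) (g : T → ℤ) → Σ (λ b → δ b c * g b) ≡ g c
  Σ-δˡ c g = ∑-δ-inside c g L uniq (complete c)

  Σ-δʳ : (c : T) (g : T → ℤ) → Σ (λ b → δ c b * g b) ≡ g c
  Σ-δʳ c g = trans (∑-cong L (λ b → cong (_* g b) (δ-sym c b))) (Σ-δˡ c g)

  Σ-δ : (c : T) → Σ (λ b → δ b c) ≡ 1ℤ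
  Σ-δ c = trans (∑-cong L (λ b → sym (ℤP.*-identityʳ (δ b c)))) (Σ-δˡ c (λ _ → 1ℤ))

  Σ-reindex : (h k : T → T) → (∀ b → k (h b) ≡ b) → (∀ c → h (k c) ≡ c) →
              (g : T → ℤ) → Σ (λ b → g (h b)) ≡ Σ g
  Σ-reindex h k kh hk g = begin
      Σ (λ b → g (h b))
    ≡⟨ ∑-cong L (λ b → sym (Σ-δʳ (h b) g)) ⟩
      Σ (λ b → Σ (λ c → δ (h b) c * g c))
    ≡⟨ ∑-swap L L _ ⟩
      Σ (λ c → Σ (λ b → δ (h b) c * g c))
    ≡⟨ ∑-cong L (λ c → ∑-*ʳ L (g c) (λ b → δ (h b) c)) ⟩
      Σ (λ c → Σ (λ b → δ (h b) c) * g c)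
    ≡⟨ ∑-cong L (λ c → cong (_* g c) (trans (∑-cong L (λ b → δ-transpose b c)) (Σ-δ (k c)))) ⟩
      Σ (λ c → 1ℤ * g c)
    ≡⟨ ∑-cong L (λ c → ℤP.*-identityˡ (g c)) ⟩
      Σ g ∎
    where
    open ≡-Reasoning
    δ-transpose : ∀ b c → δ (h b) c ≡ δ b (k c)
    δ-transpose b c with h b ≟ c | b ≟ k c
    ... | yes _ | yes _ = refl
    ... | no _ | no _ = refl
    ... | yes p | no q = ⊥-elim (q (trans (sym (kh b)) (cong k p)))
    ... | no p | yes q = ⊥-elim (p (trans (cong h q) (hk c)))

  term≤Σ : (g : T → ℤ) → (∀ a → 0ℤ ≤ g a) → ∀ c → g c ≤ Σ g
  term≤Σ g g≥0 c = member≤∑ L (complete c)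
    where
    ∑≥0 : ∀ M → 0ℤ ≤ ∑ M g
    ∑≥0 [] = ℤP.≤-refl
    ∑≥0 (x ∷ M) = ℤP.+-mono-≤ (g≥0 x) (∑≥0 M)
    member≤∑ : ∀ M → c ∈ M → g c ≤ ∑ M g
    member≤∑ (x ∷ M) (here refl) = subst (_≤ g c + ∑ M g) (ℤP.+-identityʳ (g c)) (ℤP.+-monoʳ-≤ (g c) (∑≥0 M))
    member≤∑ (x ∷ M) (there c∈M) = subst (_≤ g x + ∑ M g) (ℤP.+-identityˡ (g c)) (ℤP.+-mono-≤ (g≥0 x) (member≤∑ M c∈M))

module AbelianGroupLaws (A : AbelianGroup 0ℓ 0ℓ)
  (≈⇒≡ : ∀ {x y : AbelianGroup.Carrier A} → AbelianGroup._≈_ A x y → x ≡ y) where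

  open import Relation.Binary.PropositionalEquality
  import Algebra.Properties.AbelianGroup as AbelianGroupProperties
  import Algebra.Solver.CommutativeMonoid
  open AbelianGroup A using (Carrier; _∙_; ε; _⁻¹; rawGroup; commutativeMonoid)
  private
    module AG = AbelianGroup A
    module AGP = AbelianGroupProperties A

  module CommutativeMonoidSolver = Algebra.Solver.CommutativeMonoid commutativeMonoid

  assoc : ∀ x y z → (x ∙ y) ∙ z ≡ x ∙ (y ∙ z)
  assoc x y z = ≈⇒≡ (AG.assoc x y z)

  comm : ∀ x y → x ∙ y ≡ y ∙ x
  comm x y = ≈⇒≡ (AG.comm x y)

  identityˡ : ∀ x → ε ∙ x ≡ x
  identityˡ x = ≈⇒≡ (AG.identityˡ x)

  identityʳ : ∀ x → x ∙ ε ≡ x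
  identityʳ x = ≈⇒≡ (AG.identityʳ x)

  inverseˡ : ∀ x → x ⁻¹ ∙ x ≡ ε
  inverseˡ x = ≈⇒≡ (AG.inverseˡ x)

  inverseʳ : ∀ x → x ∙ x ⁻¹ ≡ ε
  inverseʳ x = ≈⇒≡ (AG.inverseʳ x)

  ⁻¹-involutive : ∀ x → (x ⁻¹) ⁻¹ ≡ x
  ⁻¹-involutive x = ≈⇒≡ (AGP.⁻¹-involutive x)

  ⁻¹-∙ : ∀ x y → (x ∙ y) ⁻¹ ≡ x ⁻¹ ∙ y ⁻¹
  ⁻¹-∙ x y = sym (≈⇒≡ (AGP.⁻¹-∙-comm x y))

  ε⁻¹≡ε : ε ⁻¹ ≡ ε
  ε⁻¹≡ε = ≈⇒≡ AGP.ε⁻¹≈ε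

  ⁻¹-cancelˡ : ∀ x y → x ⁻¹ ∙ (x ∙ y) ≡ y
  ⁻¹-cancelˡ x y = trans (sym (assoc _ _ _)) (trans (cong (_∙ y) (inverseˡ x)) (identityˡ y))

  ⁻¹-cancelʳ : ∀ x y → x ∙ (x ⁻¹ ∙ y) ≡ y
  ⁻¹-cancelʳ x y = trans (sym (assoc _ _ _)) (trans (cong (_∙ y) (inverseʳ x)) (identityˡ y))

  ⁻¹∙-involutive : ∀ a b → (b ⁻¹ ∙ a) ⁻¹ ∙ a ≡ b
  ⁻¹∙-involutive a b = begin
      (b ⁻¹ ∙ a) ⁻¹ ∙ a     ≡⟨ cong (_∙ a) (trans (⁻¹-∙ (b ⁻¹) a) (cong (_∙ a ⁻¹) (⁻¹-involutive b))) ⟩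
      (b ∙ a ⁻¹) ∙ a        ≡⟨ assoc b (a ⁻¹) a ⟩
      b ∙ (a ⁻¹ ∙ a)        ≡⟨ cong (b ∙_) (inverseˡ a) ⟩
      b ∙ ε                 ≡⟨ identityʳ b ⟩
      b                     ∎
    where open ≡-Reasoning

  module Endomorphism {f : Carrier → Carrier} (hom : IsGroupHomomorphism rawGroup rawGroup f) where
    private module H = IsGroupHomomorphism hom

    f-∙ : ∀ x y → f (x ∙ y) ≡ f x ∙ f y
    f-∙ x y = ≈⇒≡ (H.homo x y)

    f-ε : f ε ≡ ε
    f-ε = ≈⇒≡ H.ε-homo

    f-⁻¹ : ∀ x → f (x ⁻¹) ≡ f x ⁻¹
    f-⁻¹ x = ≈⇒≡ (H.⁻¹-homo x)

module GroupRing (A : AbelianGroup 0ℓ 0ℓ)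
  (≈⇒≡ : ∀ {x y : AbelianGroup.Carrier A} → AbelianGroup._≈_ A x y → x ≡ y)
  (_≟_ : DecidableEquality (AbelianGroup.Carrier A))
  (elems : List (AbelianGroup.Carrier A)) (uniq : Unique elems)
  (complete : ∀ x → x ∈ elems) where

  open import Data.Integer using (ℤ; +_; -[1+_]; _+_; _*_; -_; _-_; 0ℤ; 1ℤ; _≤_; +≤+)
  import Data.Integer.Properties as ℤP
  import Data.Integer.Base as ℤB
  open import Data.Integer.Tactic.RingSolver using (solve-∀)
  open import Data.Nat using (suc; z≤n; s≤s)
  open import Data.Product using (_,_)
  open import Data.Sum using (_⊎_; inj₁; inj₂)
  open import Data.Maybe using (Maybe; just; nothing)
  open import Data.Empty using (⊥-elim)
  open import Function using (const)
  open import Relation.Nullary using (yes; no)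
  open import Relation.Binary.PropositionalEquality hiding ([_])
  open import Algebra.Bundles using (CommutativeRing)
  open import Algebra.Structures using (IsCommutativeRing)
  import Algebra.Construct.Pointwise as Pointwise
  open import Algebra.Solver.Ring.AlmostCommutativeRing
    using (fromCommutativeRing; _-Raw-AlmostCommutative⟶_)
  open AbelianGroup A using (Carrier; _∙_; ε; _⁻¹)
  open AbelianGroupLaws A ≈⇒≡
  open ListSum
  open FiniteSum _≟_ elems uniq complete public

  ZA : Set
  ZA = Carrier → ℤ

  infix 4 _≐_
  _≐_ : ZA → ZA → Set
  u ≐ v = ∀ a → u a ≡ v a

  ≐-sym : ∀ {u v} → u ≐ v → v ≐ u
  ≐-sym p a = sym (p a)

  ≐-trans : ∀ {u v w} → u ≐ v → v ≐ w → u ≐ w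
  ≐-trans p q a = trans (p a) (q a)

  infixl 6 _⊕_
  infixl 7 _⋆_

  _⊕_ : ZA → ZA → ZA
  (u ⊕ v) a = u a + v a

  ⊖_ : ZA → ZA
  (⊖ u) a = - u a

  𝟘 : ZA
  𝟘 _ = 0ℤ

  [_] : Carrier → ZA
  [ c ] a = δ a c

  𝟙 : ZA
  𝟙 = [ ε ]

  Ā : ZA
  Ā _ = 1ℤ

  scal : ℤ → ZA → ZA
  scal k u a = k * u a

  _⋆_ : ZA → ZA → ZA
  (u ⋆ v) a = Σ (λ b → u b * v (b ⁻¹ ∙ a))

  aug : ZA → ℤ
  aug = Σ

  Σ-⁻¹ : (g : ZA) → Σ (λ b → g (b ⁻¹)) ≡ Σ g
  Σ-⁻¹ = Σ-reindex _⁻¹ _⁻¹ ⁻¹-involutive ⁻¹-involutive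

  Σ-translate : (c : Carrier) (g : ZA) → Σ (λ b → g (c ∙ b)) ≡ Σ g
  Σ-translate c = Σ-reindex (c ∙_) (c ⁻¹ ∙_) (⁻¹-cancelˡ c) (⁻¹-cancelʳ c)

  Σ-⁻¹∙ : (a : Carrier) (g : ZA) → Σ (λ b → g (b ⁻¹ ∙ a)) ≡ Σ g
  Σ-⁻¹∙ a = Σ-reindex (λ b → b ⁻¹ ∙ a) (λ b → b ⁻¹ ∙ a) (⁻¹∙-involutive a) (⁻¹∙-involutive a)

  ⋆-cong : ∀ {u u' v v'} → u ≐ u' → v ≐ v' → u ⋆ v ≐ u' ⋆ v'
  ⋆-cong eu ev a = ∑-cong elems (λ b → cong₂ _*_ (eu b) (ev (b ⁻¹ ∙ a)))

  ⋆-congˡ : ∀ {u u'} v → u ≐ u' → u ⋆ v ≐ u' ⋆ v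
  ⋆-congˡ {u} {u'} v eu = ⋆-cong {u} {u'} {v} {v} eu (λ _ → refl)

  ⋆-congʳ : ∀ u {v v'} → v ≐ v' → u ⋆ v ≐ u ⋆ v'
  ⋆-congʳ u {v} {v'} = ⋆-cong {u} {u} {v} {v'} (λ _ → refl)

  ⋆-comm : ∀ u v → u ⋆ v ≐ v ⋆ u
  ⋆-comm u v a = begin
      Σ (λ b → u b * v (b ⁻¹ ∙ a))
    ≡⟨ ∑-cong elems (λ b → trans (ℤP.*-comm (u b) _) (cong (λ c → v (b ⁻¹ ∙ a) * u c) (sym (⁻¹∙-involutive a b)))) ⟩
      Σ (λ b → v (b ⁻¹ ∙ a) * u ((b ⁻¹ ∙ a) ⁻¹ ∙ a))
    ≡⟨ Σ-⁻¹∙ a (λ c → v c * u (c ⁻¹ ∙ a)) ⟩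
      Σ (λ c → v c * u (c ⁻¹ ∙ a)) ∎
    where open ≡-Reasoning

  ⋆-identityˡ : ∀ u → 𝟙 ⋆ u ≐ u
  ⋆-identityˡ u a = trans (Σ-δˡ ε (λ b → u (b ⁻¹ ∙ a))) (cong u (trans (cong (_∙ a) ε⁻¹≡ε) (identityˡ a)))

  ⋆-identityʳ : ∀ u → u ⋆ 𝟙 ≐ u
  ⋆-identityʳ u = ≐-trans (⋆-comm u 𝟙) (⋆-identityˡ u)

  ⋆-distribˡ : ∀ u v w → u ⋆ (v ⊕ w) ≐ u ⋆ v ⊕ u ⋆ w
  ⋆-distribˡ u v w a = trans (∑-cong elems (λ b → ℤP.*-distribˡ-+ (u b) _ _)) (∑-+ elems _ _)

  ⋆-distribʳ : ∀ u v w → (v ⊕ w) ⋆ u ≐ v ⋆ u ⊕ w ⋆ u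
  ⋆-distribʳ u v w a = trans (∑-cong elems (λ b → ℤP.*-distribʳ-+ (u (b ⁻¹ ∙ a)) (v b) (w b))) (∑-+ elems _ _)

  ⋆-assoc : ∀ u v w → (u ⋆ v) ⋆ w ≐ u ⋆ (v ⋆ w)
  ⋆-assoc u v w a = begin
      Σ (λ b → Σ (λ c → u c * v (c ⁻¹ ∙ b)) * w (b ⁻¹ ∙ a))
    ≡⟨ ∑-cong elems (λ b → sym (∑-*ʳ elems _ _)) ⟩
      Σ (λ b → Σ (λ c → u c * v (c ⁻¹ ∙ b) * w (b ⁻¹ ∙ a)))
    ≡⟨ ∑-swap elems elems _ ⟩
      Σ (λ c → Σ (λ b → u c * v (c ⁻¹ ∙ b) * w (b ⁻¹ ∙ a)))
    ≡⟨ ∑-cong elems (λ c → sym (Σ-translate c (λ b → u c * v (c ⁻¹ ∙ b) * w (b ⁻¹ ∙ a)))) ⟩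
      Σ (λ c → Σ (λ d → u c * v (c ⁻¹ ∙ (c ∙ d)) * w ((c ∙ d) ⁻¹ ∙ a)))
    ≡⟨ ∑-cong elems (λ c → ∑-cong elems (λ d → trans (ℤP.*-assoc (u c) _ _)
          (cong (u c *_) (cong₂ _*_ (cong v (⁻¹-cancelˡ c d)) (cong w (regroup c d)))))) ⟩
      Σ (λ c → Σ (λ d → u c * (v d * w (d ⁻¹ ∙ (c ⁻¹ ∙ a)))))
    ≡⟨ ∑-cong elems (λ c → ∑-*ˡ elems (u c) _) ⟩
      Σ (λ c → u c * Σ (λ d → v d * w (d ⁻¹ ∙ (c ⁻¹ ∙ a)))) ∎
    where
    open ≡-Reasoning
    regroup : ∀ c d → (c ∙ d) ⁻¹ ∙ a ≡ d ⁻¹ ∙ (c ⁻¹ ∙ a)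
    regroup c d = trans (cong (_∙ a) (trans (⁻¹-∙ c d) (comm _ _))) (assoc _ _ _)

  ZA-isCommutativeRing : IsCommutativeRing _≐_ _⊕_ _⋆_ ⊖_ 𝟘 𝟙
  ZA-isCommutativeRing = record
    { isRing = record
      { +-isAbelianGroup = Pointwise.isAbelianGroup Carrier ℤP.+-0-isAbelianGroup
      ; *-cong = ⋆-cong
      ; *-assoc = ⋆-assoc
      ; *-identity = ⋆-identityˡ , ⋆-identityʳ
      ; distrib = ⋆-distribˡ , ⋆-distribʳ }
    ; *-comm = ⋆-comm }

  ZA-commutativeRing : CommutativeRing 0ℓ 0ℓ
  ZA-commutativeRing = record { isCommutativeRing = ZA-isCommutativeRing }

  scal-⋆ : ∀ k u v → scal k u ⋆ v ≐ scal k (u ⋆ v)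
  scal-⋆ k u v a = trans (∑-cong elems (λ b → ℤP.*-assoc k (u b) _)) (∑-*ˡ elems k _)

  ⟦_⟧ : ℤ → ZA
  ⟦ k ⟧ = scal k 𝟙

  ⟦⟧-⋆ : ∀ k u → ⟦ k ⟧ ⋆ u ≐ scal k u
  ⟦⟧-⋆ k u a = trans (scal-⋆ k 𝟙 u a) (cong (k *_) (⋆-identityˡ u a))

  ℤ⟶ZA : ℤB.+-*-rawRing -Raw-AlmostCommutative⟶ fromCommutativeRing ZA-commutativeRing
  ℤ⟶ZA = record
    { ⟦_⟧ = ⟦_⟧
    ; +-homo = λ k l a → ℤP.*-distribʳ-+ (δ a ε) k l
    ; *-homo = λ k l a → trans (ℤP.*-assoc k l (δ a ε)) (sym (⟦⟧-⋆ k ⟦ l ⟧ a))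
    ; -‿homo = λ k a → sym (ℤP.neg-distribˡ-* k (δ a ε))
    ; 0-homo = λ a → refl
    ; 1-homo = λ a → ℤP.*-identityˡ (δ a ε)
    }

  ⟦⟧-≟ : ∀ k l → Maybe (⟦ k ⟧ ≐ ⟦ l ⟧)
  ⟦⟧-≟ k l with k ℤP.≟ l
  ... | yes refl = just (λ a → refl)
  ... | no _ = nothing

  open import Algebra.Solver.Ring ℤB.+-*-rawRing (fromCommutativeRing ZA-commutativeRing) ℤ⟶ZA ⟦⟧-≟ public
    using (solve; _:=_; _:+_; _:*_; _:-_; con)

  aug-⊕ : ∀ u v → aug (u ⊕ v) ≡ aug u + aug v
  aug-⊕ = ∑-+ elems

  aug-⊖ : ∀ u → aug (⊖ u) ≡ - aug u
  aug-⊖ = ∑-neg elems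

  aug-⟦⟧ : ∀ k → aug ⟦ k ⟧ ≡ k
  aug-⟦⟧ k = trans (∑-*ˡ elems k (λ a → δ a ε)) (trans (cong (k *_) (Σ-δ ε)) (ℤP.*-identityʳ k))

  aug-const : ∀ {u} k → u ≐ const k → aug u ≡ k * aug Ā
  aug-const k u≐k = trans (∑-cong elems u≐k) (trans (∑-cong elems (λ _ → sym (ℤP.*-identityʳ k))) (∑-*ˡ elems k Ā))

  aug-⋆ : ∀ u v → aug (u ⋆ v) ≡ aug u * aug v
  aug-⋆ u v = begin
      Σ (λ a → Σ (λ b → u b * v (b ⁻¹ ∙ a)))
    ≡⟨ ∑-swap elems elems _ ⟩
      Σ (λ b → Σ (λ a → u b * v (b ⁻¹ ∙ a)))
    ≡⟨ ∑-cong elems (λ b → trans (∑-*ˡ elems (u b) _) (cong (u b *_) (Σ-translate (b ⁻¹) v))) ⟩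
      Σ (λ b → u b * Σ v)
    ≡⟨ ∑-*ʳ elems (Σ v) u ⟩
      Σ u * Σ v ∎
    where open ≡-Reasoning

  ⋆-const : ∀ u k → u ⋆ const k ≐ const (aug u * k)
  ⋆-const u k a = ∑-*ʳ elems k u

  ⋆-Ā : ∀ u → u ⋆ Ā ≐ const (aug u)
  ⋆-Ā u a = trans (⋆-const u 1ℤ a) (ℤP.*-identityʳ (aug u))

  [_]-⋆ : ∀ c u w → ([ c ] ⋆ u) w ≡ u (c ⁻¹ ∙ w)
  [ c ]-⋆ u w = Σ-δˡ c (λ b → u (b ⁻¹ ∙ w))

  aug-[] : ∀ c → aug [ c ] ≡ 1ℤ
  aug-[] = Σ-δ

  ⋆-vanishˡ : ∀ {u} v → u ≐ 𝟘 → u ⋆ v ≐ 𝟘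
  ⋆-vanishˡ {u} v u≐𝟘 a =
    trans (∑-cong elems (λ b → trans (cong (_* v (b ⁻¹ ∙ a)) (u≐𝟘 b)) (ℤP.*-zeroˡ (v (b ⁻¹ ∙ a))))) (∑-zero elems)

  infix 10 _†
  _† : ZA → ZA
  (u †) a = u (a ⁻¹)

  SelfAdjoint : ZA → Set
  SelfAdjoint u = u † ≐ u

  †-⋆ : ∀ u v → (u ⋆ v) † ≐ u † ⋆ v †
  †-⋆ u v a = sym (trans (sym (Σ-⁻¹ (λ b → u (b ⁻¹) * v ((b ⁻¹ ∙ a) ⁻¹))))
                 (∑-cong elems (λ b → cong₂ _*_ (cong u (⁻¹-involutive b))
                    (cong v (trans (⁻¹-∙ _ _) (cong (_∙ a ⁻¹) (⁻¹-involutive (b ⁻¹))))))))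

  ⋆†-at-ε : ∀ (u : ZA) → (u ⋆ u †) ε ≡ Σ (λ b → u b * u b)
  ⋆†-at-ε u = ∑-cong elems (λ b → cong (λ c → u b * u c) (b⁻¹ε⁻¹ b))
    where
    b⁻¹ε⁻¹ : ∀ b → (b ⁻¹ ∙ ε) ⁻¹ ≡ b
    b⁻¹ε⁻¹ b = trans (cong _⁻¹ (identityʳ (b ⁻¹))) (⁻¹-involutive b)

  ⋆-at-ε : ∀ (u : ZA) → SelfAdjoint u → (u ⋆ u) ε ≡ Σ (λ b → u b * u b)
  ⋆-at-ε u sa = trans (⋆-congʳ u (≐-sym sa) ε) (⋆†-at-ε u)

  private
    square≥0 : ∀ i → 0ℤ ≤ i * i
    square≥0 (+ n) = subst (0ℤ ≤_) (ℤP.pos-* n n) (+≤+ z≤n)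
    square≥0 -[1+ n ] = +≤+ z≤n

    square≡0 : ∀ i → i * i ≡ 0ℤ → i ≡ 0ℤ
    square≡0 i i²≡0 with ℤP.i*j≡0⇒i≡0∨j≡0 i i²≡0
    ... | inj₁ i≡0 = i≡0
    ... | inj₂ i≡0 = i≡0

    0≤i≤1 : ∀ i → 0ℤ ≤ i → i ≤ 1ℤ → i ≡ 0ℤ ⊎ i ≡ 1ℤ
    0≤i≤1 (+ 0) _ _ = inj₁ refl
    0≤i≤1 (+ 1) _ _ = inj₂ refl
    0≤i≤1 (+ suc (suc n)) _ (+≤+ (s≤s ()))
    0≤i≤1 -[1+ n ] () _

  Σ-square≥0 : ∀ (u : ZA) → 0ℤ ≤ Σ (λ b → u b * u b)
  Σ-square≥0 u = ℤP.≤-trans (square≥0 (u ε)) (term≤Σ (λ b → u b * u b) (λ b → square≥0 (u b)) ε)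

  Σ-square≡0 : ∀ (u : ZA) → Σ (λ b → u b * u b) ≡ 0ℤ → u ≐ 𝟘
  Σ-square≡0 u Σu²≡0 c = square≡0 (u c) (ℤP.≤-antisym
    (subst (u c * u c ≤_) Σu²≡0 (term≤Σ (λ b → u b * u b) (λ b → square≥0 (u b)) c))
    (square≥0 (u c)))

  Σ-square-shift : ∀ (u : ZA) → Σ (λ b → (u b - 𝟙 b) * (u b - 𝟙 b)) ≡ Σ (λ b → u b * u b) - (u ε + u ε - 1ℤ)
  Σ-square-shift u = begin
      Σ (λ b → (u b - 𝟙 b) * (u b - 𝟙 b))
    ≡⟨ ∑-cong elems (λ b → expand (u b) (𝟙 b)) ⟩
      Σ (λ b → u b * u b - (𝟙 b * (u b + u b) - 𝟙 b * 𝟙 b))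
    ≡⟨ ∑-minus elems (λ b → u b * u b) (λ b → 𝟙 b * (u b + u b) - 𝟙 b * 𝟙 b) ⟩
      Σ (λ b → u b * u b) - Σ (λ b → 𝟙 b * (u b + u b) - 𝟙 b * 𝟙 b)
    ≡⟨ cong (λ z → Σ (λ b → u b * u b) - z)
         (trans (∑-minus elems (λ b → 𝟙 b * (u b + u b)) (λ b → 𝟙 b * 𝟙 b))
                (cong₂ _-_ (Σ-δˡ ε (λ b → u b + u b)) (Σ-δˡ ε 𝟙))) ⟩
      Σ (λ b → u b * u b) - (u ε + u ε - 𝟙 ε)
    ≡⟨ cong (λ z → Σ (λ b → u b * u b) - (u ε + u ε - z)) (δ-refl ε) ⟩
      Σ (λ b → u b * u b) - (u ε + u ε - 1ℤ) ∎
    where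
    open ≡-Reasoning
    expand : ∀ q d → (q - d) * (q - d) ≡ q * q - (d * (q + q) - d * d)
    expand = solve-∀

  -- Q(ε) = Σ Q(b)² and Σ (Q(b) - 𝟙(b))² = 1 - Q(ε) force Q(ε) ∈ {0, 1}; Q(ε) = 1 makes Q = 𝟙.
  selfAdjoint-idempotent-vanish : ∀ Q → SelfAdjoint Q → Q ⋆ Q ≐ Q → aug Q ≡ 0ℤ → Q ≐ 𝟘
  selfAdjoint-idempotent-vanish Q sa idem augQ≡0 =
    by-Qε (0≤i≤1 (Q ε) (subst (0ℤ ≤_) ΣQ² (Σ-square≥0 Q)) Qε≤1)
    where
    ΣQ² : Σ (λ b → Q b * Q b) ≡ Q ε
    ΣQ² = trans (sym (⋆-at-ε Q sa)) (idem ε)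
    ΣQ-𝟙² : Σ (λ b → (Q b - 𝟙 b) * (Q b - 𝟙 b)) ≡ 1ℤ - Q ε
    ΣQ-𝟙² = trans (Σ-square-shift Q) (trans (cong (_- (Q ε + Q ε - 1ℤ)) ΣQ²) (simplify (Q ε)))
      where
      simplify : ∀ q → q - (q + q - 1ℤ) ≡ 1ℤ - q
      simplify = solve-∀
    Qε≤1 : Q ε ≤ 1ℤ
    Qε≤1 = ℤP.≤-trans (ℤP.≤-reflexive (sym (ℤP.+-identityʳ (Q ε))))
             (subst (Q ε + 0ℤ ≤_) (cancel (Q ε))
               (ℤP.+-monoʳ-≤ (Q ε) (subst (0ℤ ≤_) ΣQ-𝟙² (Σ-square≥0 (λ b → Q b - 𝟙 b)))))
      where
      cancel : ∀ q → q + (1ℤ - q) ≡ 1ℤ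
      cancel = solve-∀
    by-Qε : Q ε ≡ 0ℤ ⊎ Q ε ≡ 1ℤ → Q ≐ 𝟘
    by-Qε (inj₁ Qε≡0) = Σ-square≡0 Q (trans ΣQ² Qε≡0)
    by-Qε (inj₂ Qε≡1) = ⊥-elim (1≢0 (trans (sym augQ≡1) augQ≡0))
      where
      Q≐𝟙 : Q ≐ 𝟙
      Q≐𝟙 b = ℤP.i-j≡0⇒i≡j _ _ (Σ-square≡0 (λ b → Q b - 𝟙 b) (trans ΣQ-𝟙² (cong (λ z → 1ℤ - z) Qε≡1)) b)
      augQ≡1 : aug Q ≡ 1ℤ
      augQ≡1 = trans (∑-cong elems Q≐𝟙) (Σ-δ ε)
      1≢0 : 1ℤ ≢ 0ℤ
      1≢0 ()

  selfAdjoint-nilpotent-vanish : ∀ P → SelfAdjoint P → P ⋆ P ≐ 𝟘 → P ≐ 𝟘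
  selfAdjoint-nilpotent-vanish P sa P²≐𝟘 = Σ-square≡0 P (trans (sym (⋆-at-ε P sa)) (P²≐𝟘 ε))

  -- P = V V† is self-adjoint with P³ = P, so P² is a self-adjoint idempotent of augmentation 0;
  -- hence P² = 0, P = 0 and Σ V(b)² = P(ε) = 0.
  cube-vanish : ∀ {V} → V ⋆ V ⋆ V ≐ V → aug V ≡ 0ℤ → V ≐ 𝟘
  cube-vanish {V} V³≐V augV≡0 = Σ-square≡0 V (trans (sym (⋆†-at-ε V)) (P≐𝟘 ε))
    where
    open import Relation.Binary.Reasoning.Setoid (CommutativeRing.setoid ZA-commutativeRing)
    P : ZA
    P = V ⋆ V †
    P-selfAdjoint : SelfAdjoint P
    P-selfAdjoint = begin
      (V ⋆ V †) †     ≈⟨ †-⋆ V (V †) ⟩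
      V † ⋆ (V †) †   ≈⟨ ⋆-congʳ (V †) (λ a → cong V (⁻¹-involutive a)) ⟩
      V † ⋆ V         ≈⟨ ⋆-comm (V †) V ⟩
      V ⋆ V †         ∎
    V†³≐V† : V † ⋆ V † ⋆ V † ≐ V †
    V†³≐V† = begin
      V † ⋆ V † ⋆ V †     ≈⟨ ≐-sym (≐-trans (†-⋆ (V ⋆ V) V) (⋆-congˡ (V †) (†-⋆ V V))) ⟩
      (V ⋆ V ⋆ V) †       ≈⟨ (λ a → V³≐V (a ⁻¹)) ⟩
      V †                 ∎
    P³≐P : P ⋆ P ⋆ P ≐ P
    P³≐P = begin
      P ⋆ P ⋆ P
        ≈⟨ solve 2 (λ v w → (v :* w) :* (v :* w) :* (v :* w) := (v :* v :* v) :* (w :* w :* w)) (λ _ → refl) V (V †) ⟩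
      (V ⋆ V ⋆ V) ⋆ (V † ⋆ V † ⋆ V †)
        ≈⟨ ⋆-cong V³≐V V†³≐V† ⟩
      P ∎
    P²-idempotent : P ⋆ P ⋆ (P ⋆ P) ≐ P ⋆ P
    P²-idempotent = begin
      P ⋆ P ⋆ (P ⋆ P)     ≈⟨ solve 1 (λ p → (p :* p) :* (p :* p) := p :* (p :* p :* p)) (λ _ → refl) P ⟩
      P ⋆ (P ⋆ P ⋆ P)     ≈⟨ ⋆-congʳ P P³≐P ⟩
      P ⋆ P               ∎
    augP≡0 : aug P ≡ 0ℤ
    augP≡0 = trans (aug-⋆ V (V †)) (trans (cong (_* aug (V †)) augV≡0) (ℤP.*-zeroˡ (aug (V †))))
    augP²≡0 : aug (P ⋆ P) ≡ 0ℤ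
    augP²≡0 = trans (aug-⋆ P P) (trans (cong (_* aug P) augP≡0) (ℤP.*-zeroˡ (aug P)))
    P≐𝟘 : P ≐ 𝟘
    P≐𝟘 = selfAdjoint-nilpotent-vanish P P-selfAdjoint
            (selfAdjoint-idempotent-vanish (P ⋆ P) (≐-trans (†-⋆ P P) (⋆-cong P-selfAdjoint P-selfAdjoint)) P²-idempotent augP²≡0)

module GroupRingAutomorphism (A : AbelianGroup 0ℓ 0ℓ)
  (≈⇒≡ : ∀ {x y : AbelianGroup.Carrier A} → AbelianGroup._≈_ A x y → x ≡ y)
  (_≟_ : DecidableEquality (AbelianGroup.Carrier A))
  (elems : List (AbelianGroup.Carrier A)) (uniq : Unique elems)
  (complete : ∀ x → x ∈ elems)
  {f : AbelianGroup.Carrier A → AbelianGroup.Carrier A}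
  (hom : IsGroupHomomorphism (AbelianGroup.rawGroup A) (AbelianGroup.rawGroup A) f)
  (f-involutive : ∀ x → f (f x) ≡ x) where

  open import Data.Integer using (ℤ; +_; _+_; _*_; -_; _-_; 0ℤ; 1ℤ)
  import Data.Integer.Properties as ℤP
  open import Data.Integer.Tactic.RingSolver using (solve-∀)
  open import Data.Empty using (⊥-elim)
  open import Function using (const)
  open import Relation.Nullary using (yes; no)
  open import Relation.Binary.PropositionalEquality hiding ([_])
  open AbelianGroup A using (Carrier; _∙_; ε; _⁻¹)
  open AbelianGroupLaws A ≈⇒≡
  open Endomorphism hom
  open ListSum
  open GroupRing A ≈⇒≡ _≟_ elems uniq complete

  F : ZA → ZA
  F u a = u (f a)

  Σ-f : (g : ZA) → Σ (λ b → g (f b)) ≡ Σ g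
  Σ-f = Σ-reindex f f f-involutive f-involutive

  aug-F : ∀ u → aug (F u) ≡ aug u
  aug-F = Σ-f

  F-involutive : ∀ u → F (F u) ≐ u
  F-involutive u a = cong u (f-involutive a)

  F-⋆-at : ∀ u v w → (F u ⋆ v) w ≡ Σ (λ c → u c * v (f c ⁻¹ ∙ w))
  F-⋆-at u v w = trans (sym (Σ-f (λ c → u (f c) * v (c ⁻¹ ∙ w))))
                   (∑-cong elems (λ c → cong (λ z → u z * v (f c ⁻¹ ∙ w)) (f-involutive c)))

  F-⋆ : ∀ u v → F (u ⋆ v) ≐ F u ⋆ F v
  F-⋆ u v a = sym (trans (∑-cong elems (λ b → cong (λ z → u (f b) * v z)
                   (trans (f-∙ (b ⁻¹) a) (cong (_∙ f a) (f-⁻¹ b)))))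
                 (Σ-f (λ b → u b * v (b ⁻¹ ∙ f a))))

  F-[] : ∀ {c} → f c ≡ c → F [ c ] ≐ [ c ]
  F-[] {c} fc≡c a with f a ≟ c | a ≟ c
  ... | yes _ | yes _ = refl
  ... | no _ | no _ = refl
  ... | yes fa≡c | no a≢c = ⊥-elim (a≢c (trans (sym (f-involutive a)) (trans (cong f fa≡c) fc≡c)))
  ... | no fa≢c | yes a≡c = ⊥-elim (fa≢c (trans (cong f a≡c) fc≡c))

  module _ {α : Carrier} (fα≡α : f α ≡ α) (X Y : ZA) (μ : ℤ)
           (augĀ : aug Ā ≡ 1ℤ + μ + μ) (augX : aug X ≡ μ) (augY : aug Y ≡ μ)
           (E₁ : X ⋆ X ⊕ [ α ] ⋆ (F Y ⋆ Y) ⊕ X ≐ const μ)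
           (E₂ : F X ⋆ Y ⊕ Y ⋆ X ⊕ Y ≐ const μ) where

    private
      W : ZA
      W = X ⊕ F X ⊕ ⟦ 1ℤ ⟧

      augW : aug W ≡ 1ℤ + μ + μ
      augW = trans (aug-⊕ (X ⊕ F X) ⟦ 1ℤ ⟧)
               (trans (cong₂ _+_ (trans (aug-⊕ X (F X)) (cong₂ _+_ augX (trans (aug-F X) augX))) (aug-⟦⟧ 1ℤ))
                 (rearrange μ))
        where
        rearrange : ∀ m → m + m + 1ℤ ≡ 1ℤ + m + m
        rearrange = solve-∀

      F-E₁ : F X ⋆ F X ⊕ [ α ] ⋆ (F Y ⋆ Y) ⊕ F X ≐ const μ
      F-E₁ a = trans (cong₂ (λ p q → p + q + F X a) (sym (F-⋆ X X a)) (sym (F-[α]⋆ a))) (E₁ (f a))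
        where
        F-[α]⋆ : F ([ α ] ⋆ (F Y ⋆ Y)) ≐ [ α ] ⋆ (F Y ⋆ Y)
        F-[α]⋆ = ≐-trans (F-⋆ [ α ] (F Y ⋆ Y))
                   (⋆-cong (F-[] fα≡α) (≐-trans (F-⋆ (F Y) Y) (≐-trans (⋆-congˡ (F Y) (F-involutive Y)) (⋆-comm Y (F Y)))))

      R : ZA
      R = X ⋆ X ⊕ X ⊕ ⊖ (F X ⋆ F X ⊕ F X)

      R≐𝟘 : R ≐ 𝟘
      R≐𝟘 a = trans (cong (λ z → (X ⋆ X) a + X a + - z) (sym X²+X≡fX²+fX)) (ℤP.+-inverseʳ ((X ⋆ X) a + X a))
        where
        cancel-middle : ∀ p q r p' r' {m} → p + q + r ≡ m → p' + q + r' ≡ m → p + r ≡ p' + r'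
        cancel-middle p q r p' r' e e' =
          trans (shift p q r) (trans (cong (_- q) (trans e (sym e'))) (sym (shift p' q r')))
          where
          shift : ∀ p q r → p + r ≡ p + q + r - q
          shift = solve-∀
        X²+X≡fX²+fX : (X ⋆ X) a + X a ≡ (F X ⋆ F X) a + F X a
        X²+X≡fX²+fX = cancel-middle ((X ⋆ X) a) (([ α ] ⋆ (F Y ⋆ Y)) a) (X a) ((F X ⋆ F X) a) (F X a) (E₁ a) (F-E₁ a)

      c₁ : ℤ
      c₁ = (1ℤ + μ + μ) * μ - μ * μ

      -- W (X² + X) = W E₁ - α f(Y) E₂ is a multiple of Ā.
      W⋆X²⊕X : W ⋆ (X ⋆ X ⊕ X) ≐ const c₁
      W⋆X²⊕X a = trans (expand a)
        (cong₂ (λ p q → p + - q)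
          (trans (⋆-congʳ W E₁ a) (trans (⋆-const W μ a) (cong (_* μ) augW)))
          (trans (⋆-congʳ ([ α ] ⋆ F Y) E₂ a)
            (trans (⋆-const ([ α ] ⋆ F Y) μ a)
              (cong (_* μ) (trans (aug-⋆ [ α ] (F Y)) (trans (cong₂ _*_ (aug-[] α) (trans (aug-F Y) augY)) (ℤP.*-identityˡ μ)))))))
        where
        expand : W ⋆ (X ⋆ X ⊕ X) ≐
                 W ⋆ (X ⋆ X ⊕ [ α ] ⋆ (F Y ⋆ Y) ⊕ X) ⊕ ⊖ (([ α ] ⋆ F Y) ⋆ (F X ⋆ Y ⊕ Y ⋆ X ⊕ Y))
        expand = solve 5 (λ x x' y y' d → (x :+ x' :+ con 1ℤ) :* (x :* x :+ x)
                   := (x :+ x' :+ con 1ℤ) :* (x :* x :+ d :* (y' :* y) :+ x) :- (d :* y') :* (x' :* y :+ y :* x :+ y))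
                   (λ _ → refl) X (F X) Y (F Y) [ α ]

      W³ : W ⋆ W ⋆ W ≐ W ⊕ const (+ 4 * c₁)
      W³ a = trans (expand a)
        (trans (cong₂ (λ p q → W a + p + - q)
                 (trans (⟦⟧-⋆ (+ 4) (W ⋆ (X ⋆ X ⊕ X)) a) (cong (+ 4 *_) (W⋆X²⊕X a)))
                 (⋆-vanishˡ (F X ⊕ ⟦ + 3 ⟧ ⋆ X ⊕ ⟦ + 2 ⟧) R≐𝟘 a))
          (ℤP.+-identityʳ (W a + + 4 * c₁)))
        where
        expand : W ⋆ W ⋆ W ≐ W ⊕ ⟦ + 4 ⟧ ⋆ (W ⋆ (X ⋆ X ⊕ X)) ⊕ ⊖ (R ⋆ (F X ⊕ ⟦ + 3 ⟧ ⋆ X ⊕ ⟦ + 2 ⟧))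
        expand = solve 2 (λ x x' → (x :+ x' :+ con 1ℤ) :* (x :+ x' :+ con 1ℤ) :* (x :+ x' :+ con 1ℤ)
                   := (x :+ x' :+ con 1ℤ) :+ con (+ 4) :* ((x :+ x' :+ con 1ℤ) :* (x :* x :+ x))
                      :- (x :* x :+ x :- (x' :* x' :+ x')) :* (x' :+ con (+ 3) :* x :+ con (+ 2)))
                   (λ _ → refl) X (F X)

      V : ZA
      V = W ⊕ ⊖ Ā

      augV : aug V ≡ 0ℤ
      augV = trans (aug-⊕ W (⊖ Ā)) (trans (cong₂ _+_ augW (trans (aug-⊖ Ā) (cong -_ augĀ))) (ℤP.+-inverseʳ (1ℤ + μ + μ)))

      -- W³ - W and Ā³ - Ā are both the constant 4μ(μ + 1), while V Ā = 0.
      V³ : V ⋆ V ⋆ V ≐ V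
      V³ a = ℤP.i-j≡0⇒i≡j _ _ (trans (expand a)
               (trans (cong₂ (λ p q → p + - W a + - (q + - 1ℤ) + - ((V ⋆ Ā) ⋆ (⟦ + 3 ⟧ ⋆ V ⊕ ⟦ + 3 ⟧ ⋆ Ā)) a)
                        (W³ a) (trans (⋆-Ā (Ā ⋆ Ā) a) (trans (aug-⋆ Ā Ā) (cong₂ _*_ augĀ augĀ))))
               (trans (cong (λ z → W a + + 4 * c₁ + - W a + - ((1ℤ + μ + μ) * (1ℤ + μ + μ) + - 1ℤ) + - z)
                        (⋆-vanishˡ (⟦ + 3 ⟧ ⋆ V ⊕ ⟦ + 3 ⟧ ⋆ Ā) (λ b → trans (⋆-Ā V b) augV) a))
                 (collapse (W a) μ))))
        where
        expand : V ⋆ V ⋆ V ⊕ ⊖ V ≐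
                 (W ⋆ W ⋆ W ⊕ ⊖ W) ⊕ ⊖ (Ā ⋆ Ā ⋆ Ā ⊕ ⊖ Ā) ⊕ ⊖ ((V ⋆ Ā) ⋆ (⟦ + 3 ⟧ ⋆ V ⊕ ⟦ + 3 ⟧ ⋆ Ā))
        expand = solve 2 (λ w j → (w :- j) :* (w :- j) :* (w :- j) :- (w :- j)
                   := (w :* w :* w :- w) :- (j :* j :* j :- j) :- ((w :- j) :* j) :* (con (+ 3) :* (w :- j) :+ con (+ 3) :* j))
                   (λ _ → refl) W Ā
        collapse : ∀ w m → w + + 4 * ((1ℤ + m + m) * m - m * m) + - w + - ((1ℤ + m + m) * (1ℤ + m + m) + - 1ℤ) + - 0ℤ ≡ 0ℤ
        collapse = solve-∀

    X⊕FX⊕𝟙≐Ā : X ⊕ F X ⊕ 𝟙 ≐ Ā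
    X⊕FX⊕𝟙≐Ā a = trans (cong (λ z → X a + X (f a) + z) (sym (ℤP.*-identityˡ (𝟙 a))))
                   (ℤP.i-j≡0⇒i≡j (W a) 1ℤ (cube-vanish V³ augV a))

module GroupExtension (A : AbelianGroup 0ℓ 0ℓ)
  (≈⇒≡ : ∀ {x y : AbelianGroup.Carrier A} → AbelianGroup._≈_ A x y → x ≡ y)
  {f : AbelianGroup.Carrier A → AbelianGroup.Carrier A}
  (hom : IsGroupHomomorphism (AbelianGroup.rawGroup A) (AbelianGroup.rawGroup A) f)
  (f-involutive : ∀ x → f (f x) ≡ x)
  {α : AbelianGroup.Carrier A} (fα≡α : f α ≡ α) where

  open import Data.Bool using (true; false)
  open import Data.Product using (_,_)
  open import Relation.Binary.PropositionalEquality
  open import Defs using (module Construction)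
  open AbelianGroup A using (Carrier; _∙_; ε; _⁻¹)
  open AbelianGroupLaws A ≈⇒≡
  open Endomorphism hom
  open Construction A f α
  open CommutativeMonoidSolver using (solve; _⊜_; _⊕_)
  private module AG = AbelianGroup A

  e : G
  e = (ε , false)

  ·-assoc : ∀ x y z → (x · y) · z ≡ x · (y · z)
  ·-assoc (a , false) (b , false) (c , false) = cong (_, false) (assoc a b c)
  ·-assoc (a , false) (b , false) (c , true) = cong (_, true) (assoc a b c)
  ·-assoc (a , false) (b , true) (c , false) = cong (_, true) (assoc a b (f c))
  ·-assoc (a , false) (b , true) (c , true) = cong (_, false) (trans (cong (_∙ α) (assoc a b (f c))) (assoc a _ α))
  ·-assoc (a , true) (b , false) (c , false) = cong (_, true) (trans (assoc a (f b) (f c)) (cong (a ∙_) (sym (f-∙ b c))))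
  ·-assoc (a , true) (b , false) (c , true) = cong (_, false) (cong (_∙ α) (trans (assoc a (f b) (f c)) (cong (a ∙_) (sym (f-∙ b c)))))
  ·-assoc (a , true) (b , true) (c , false) = cong (_, false)
    (trans (≈⇒≡ (solve 4 (λ a b c d → ((a ⊕ b) ⊕ d) ⊕ c ⊜ (a ⊕ (b ⊕ c)) ⊕ d) AG.refl a (f b) c α))
      (cong (λ z → (a ∙ z) ∙ α) (trans (cong (f b ∙_) (sym (f-involutive c))) (sym (f-∙ b (f c))))))
  ·-assoc (a , true) (b , true) (c , true) = cong (_, true)
    (trans (≈⇒≡ (solve 4 (λ a b c d → ((a ⊕ b) ⊕ d) ⊕ c ⊜ a ⊕ ((b ⊕ c) ⊕ d)) AG.refl a (f b) c α))
      (cong (a ∙_) (sym (trans (f-∙ _ α) (cong₂ _∙_ (trans (f-∙ b (f c)) (cong (f b ∙_) (f-involutive c))) fα≡α)))))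

  ·-identityˡ : ∀ x → e · x ≡ x
  ·-identityˡ (b , false) = cong (_, false) (identityˡ b)
  ·-identityˡ (b , true) = cong (_, true) (identityˡ b)

  ·-identityʳ : ∀ x → x · e ≡ x
  ·-identityʳ (a , false) = cong (_, false) (identityʳ a)
  ·-identityʳ (a , true) = cong (_, true) (trans (cong (a ∙_) f-ε) (identityʳ a))

  ·-inverseˡ : ∀ x → inv x · x ≡ e
  ·-inverseˡ (a , false) = cong (_, false) (inverseˡ a)
  ·-inverseˡ (a , true) = cong (_, false)
    (trans (≈⇒≡ (solve 4 (λ x y z w → ((x ⊕ y) ⊕ z) ⊕ w ⊜ (y ⊕ z) ⊕ (x ⊕ w)) AG.refl (α ⁻¹) (f (a ⁻¹)) (f a) α))
      (trans (cong₂ _∙_ (trans (cong (_∙ f a) (f-⁻¹ a)) (inverseˡ (f a))) (inverseˡ α)) (identityˡ ε)))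

  ·-inverseʳ : ∀ x → x · inv x ≡ e
  ·-inverseʳ (a , false) = cong (_, false) (inverseʳ a)
  ·-inverseʳ (a , true) = cong (_, false)
    (trans (cong (λ z → (a ∙ z) ∙ α) (trans (f-∙ _ _) (cong₂ _∙_ (trans (f-⁻¹ α) (cong _⁻¹ fα≡α)) (f-involutive (a ⁻¹)))))
      (trans (≈⇒≡ (solve 4 (λ a b c d → (a ⊕ (b ⊕ c)) ⊕ d ⊜ (a ⊕ c) ⊕ (b ⊕ d)) AG.refl a (α ⁻¹) (a ⁻¹) α))
        (trans (cong₂ _∙_ (inverseʳ a) (inverseˡ α)) (identityˡ ε))))

  isGroup : IsGroup _≡_ _·_ e inv
  isGroup = record
    { isMonoid = record
      { isSemigroup = record
        { isMagma = record { isEquivalence = isEquivalence ; ∙-cong = cong₂ _·_ }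
        ; assoc = ·-assoc }
      ; identity = ·-identityˡ , ·-identityʳ }
    ; inverse = ·-inverseˡ , ·-inverseʳ
    ; ⁻¹-cong = cong inv }

module CayleyGraph {G : Set} {_·_ : G → G → G} {e : G} {inv : G → G}
  (isGroup : IsGroup _≡_ _·_ e inv) (_≟_ : DecidableEquality G)
  (elems : List G) (uniq : Unique elems) (complete : ∀ x → x ∈ elems)
  (S : G → Bool) where

  open import Data.Nat using (suc)
  import Data.Nat.Properties as ℕP
  open import Data.Integer using (ℤ; +_; _+_; _*_; _-_; 0ℤ)
  import Data.Integer.Properties as ℤP
  open import Data.Integer.Tactic.RingSolver using (solve-∀)
  open import Data.Bool using (true; false; _∧_; if_then_else_)
  open import Data.Product using (_×_; _,_)
  open import Function.Bundles using (_⇔_; mk⇔)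
  open import Relation.Nullary using (yes; no)
  open import Relation.Binary.PropositionalEquality
  open import Algebra.Bundles using (Group)
  import Algebra.Properties.Group as GroupProperties
  open import Defs using (count; IsDSRG)
  open ListSum
  open FiniteSum _≟_ elems uniq complete
  open IsGroup isGroup using (assoc; identityˡ; identityʳ; inverseˡ; inverseʳ)
  private
    group : Group 0ℓ 0ℓ
    group = record { isGroup = isGroup }

    module GP = GroupProperties group

  arc : G → G → Bool
  arc x y = S (y · inv x)

  s : G → ℤ
  s g = ι (S g)

  s² : G → ℤ
  s² g = Σ (λ h → s h * s (g · inv h))

  private
    inv-cancelʳ : ∀ z x → (z · inv x) · x ≡ z
    inv-cancelʳ z x = trans (assoc z (inv x) x) (trans (cong (z ·_) (inverseˡ x)) (identityʳ z))

    cancel-invʳ : ∀ h x → (h · x) · inv x ≡ h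
    cancel-invʳ h x = trans (assoc h x (inv x)) (trans (cong (h ·_) (inverseʳ x)) (identityʳ h))

    Σ-·inv : ∀ x (g : G → ℤ) → Σ (λ z → g (z · inv x)) ≡ Σ g
    Σ-·inv x = Σ-reindex (_· inv x) (_· x) (λ z → inv-cancelʳ z x) (λ h → cancel-invʳ h x)

  count-2-paths : ∀ x y → + count (λ z → arc x z ∧ arc z y) elems ≡ s² (y · inv x)
  count-2-paths x y = begin
      + count (λ z → arc x z ∧ arc z y) elems
    ≡⟨ count≡∑ι _ elems ⟩
      Σ (λ z → ι (S (z · inv x) ∧ S (y · inv z)))
    ≡⟨ ∑-cong elems (λ z → trans (ι-∧ (S (z · inv x)) (S (y · inv z)))
          (cong (λ w → s (z · inv x) * s (y · inv w)) (sym (inv-cancelʳ z x)))) ⟩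
      Σ (λ z → s (z · inv x) * s (y · inv ((z · inv x) · x)))
    ≡⟨ Σ-·inv x (λ h → s h * s (y · inv (h · x))) ⟩
      Σ (λ h → s h * s (y · inv (h · x)))
    ≡⟨ ∑-cong elems (λ h → cong (λ w → s h * s w)
          (trans (cong (y ·_) (GP.⁻¹-anti-homo-∙ h x)) (sym (assoc y (inv x) (inv h))))) ⟩
      s² (y · inv x) ∎
    where open ≡-Reasoning

  count-out : ∀ x → + count (arc x) elems ≡ Σ s
  count-out x = trans (count≡∑ι _ elems) (Σ-·inv x s)

  count-in : ∀ x → + count (λ z → arc z x) elems ≡ Σ s
  count-in x = trans (count≡∑ι _ elems) (Σ-reindex (λ z → x · inv z) (λ h → inv h · x) back forth s)
    where
    back : ∀ z → inv (x · inv z) · x ≡ z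
    back z = trans (cong (_· x) (trans (GP.⁻¹-anti-homo-∙ x (inv z)) (cong (_· inv x) (GP.⁻¹-involutive z))))
               (inv-cancelʳ z x)
    forth : ∀ h → x · inv (inv h · x) ≡ h
    forth h = trans (cong (x ·_) (trans (GP.⁻¹-anti-homo-∙ (inv h) x) (cong (inv x ·_) (GP.⁻¹-involutive h))))
                (trans (sym (assoc x (inv x) h)) (trans (cong (_· h) (inverseʳ x)) (identityˡ h)))

  private
    if+ι : ∀ b {l m} → suc l ≡ m → + (if b then l else m) + ι b ≡ + m
    if+ι true {l} 1+l≡m = trans (sym (ℤP.pos-+ l 1)) (cong +_ (trans (ℕP.+-comm l 1) 1+l≡m))
    if+ι false _ = ℤP.+-identityʳ _

    if+ι⁻¹ : ∀ b c {l m} → suc l ≡ m → + c + ι b ≡ + m → c ≡ (if b then l else m)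
    if+ι⁻¹ b c 1+l≡m eq = ℤP.+-injective (cancelʳ (+ c) _ (ι b) (trans eq (sym (if+ι b 1+l≡m))))
      where
      cancelʳ : ∀ i j k → i + k ≡ j + k → i ≡ j
      cancelʳ i j k eq = trans (shift i k) (trans (cong (_- k) eq) (sym (shift j k)))
        where
        shift : ∀ i k → i ≡ i + k - k
        shift = solve-∀

    ·inv-e : ∀ g → g · inv e ≡ g
    ·inv-e g = trans (cong (g ·_) GP.ε⁻¹≈ε) (identityʳ g)

  isDSRG⇔ : ∀ {N k μ lam} → S e ≡ false → suc lam ≡ μ → count (λ _ → true) elems ≡ N →
            IsDSRG elems arc N k μ lam μ ⇔ (Σ s ≡ + k × (∀ g → s² g + s g ≡ + μ))
  isDSRG⇔ {N} {k} {μ} {lam} Se≡false 1+lam≡μ size = mk⇔ to from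
    where
    se≡0 : s e ≡ 0ℤ
    se≡0 = cong ι Se≡false

    to : IsDSRG elems arc N k μ lam μ → Σ s ≡ + k × (∀ g → s² g + s g ≡ + μ)
    to (_ , _ , out , _ , t , two-paths) = trans (sym (count-out e)) (cong +_ (out e)) , s²+s
      where
      s²+s : ∀ g → s² g + s g ≡ + μ
      s²+s g with g ≟ e
      ... | yes refl = trans (cong₂ _+_ (trans (cong s² (sym (inverseʳ e))) (sym (count-2-paths e e))) se≡0)
                         (trans (ℤP.+-identityʳ _) (cong +_ (t e)))
      ... | no g≢e = begin
          s² g + s g
        ≡⟨ cong₂ (λ h h' → s² h + s h') (sym (·inv-e g)) (sym (·inv-e g)) ⟩
          s² (g · inv e) + s (g · inv e)
        ≡⟨ cong (_+ s (g · inv e)) (sym (count-2-paths e g)) ⟩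
          + count (λ z → arc e z ∧ arc z g) elems + s (g · inv e)
        ≡⟨ cong (λ c → + c + s (g · inv e)) (two-paths e g (λ e≡g → g≢e (sym e≡g))) ⟩
          + (if arc e g then lam else μ) + ι (arc e g)
        ≡⟨ if+ι (arc e g) 1+lam≡μ ⟩
          + μ ∎
        where open ≡-Reasoning

    from : Σ s ≡ + k × (∀ g → s² g + s g ≡ + μ) → IsDSRG elems arc N k μ lam μ
    from (Σs≡k , s²+s) =
        size
      , (λ x → trans (cong S (inverseʳ x)) Se≡false)
      , (λ x → ℤP.+-injective (trans (count-out x) Σs≡k))
      , (λ x → ℤP.+-injective (trans (count-in x) Σs≡k))
      , (λ x → ℤP.+-injective (trans (count-2-paths x x) (trans (cong s² (inverseʳ x))
           (trans (sym (ℤP.+-identityʳ _)) (trans (cong (λ z → s² e + z) (sym se≡0)) (s²+s e))))))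
      , (λ x y _ → if+ι⁻¹ (arc x y) _ 1+lam≡μ (trans (cong (_+ s (y · inv x)) (count-2-paths x y)) (s²+s (y · inv x))))

module OddOrder where

  open import Data.Nat
  open import Data.Nat.Properties
  open import Data.Nat.DivMod
  open import Data.Product using (_×_; _,_)
  open import Relation.Binary.PropositionalEquality

  half-double : ∀ k → (k + k) / 2 ≡ k
  half-double k = trans (cong (_/ 2) (trans (cong (k +_) (sym (+-identityʳ k))) (*-comm 2 k))) (m*n/n≡m k 2)

  odd≡1+double : ∀ n → n % 2 ≡ 1 → n ≡ suc (n / 2 + n / 2)
  odd≡1+double n odd = trans (m≡m%n+[m/n]*n n 2)
    (trans (cong (_+ n / 2 * 2) odd) (cong suc (trans (*-comm (n / 2) 2) (cong (n / 2 +_) (+-identityʳ (n / 2))))))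

  odd-parameters : ∀ n → 3 ≤ n → n % 2 ≡ 1 →
                   n ≡ suc ((n ∸ 1) / 2 + (n ∸ 1) / 2) × suc ((n ∸ 3) / 2) ≡ (n ∸ 1) / 2
  odd-parameters n 3≤n odd = from-double n (n / 2) (odd≡1+double n odd) 3≤n
    where
    from-double : ∀ n k → n ≡ suc (k + k) → 3 ≤ n →
                  n ≡ suc ((n ∸ 1) / 2 + (n ∸ 1) / 2) × suc ((n ∸ 3) / 2) ≡ (n ∸ 1) / 2
    from-double n zero refl (s≤s ())
    from-double n (suc j) refl _ =
        cong suc (sym (cong₂ _+_ (half-double (suc j)) (half-double (suc j))))
      , trans (cong (λ m → suc ((m ∸ 1) / 2)) (+-suc j j)) (trans (cong suc (half-double j)) (sym (half-double (suc j))))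

  odd≢even : ∀ a b → suc (a + a) ≢ b + b
  odd≢even zero zero ()
  odd≢even (suc a) zero ()
  odd≢even zero (suc b) p with trans (suc-injective p) (+-suc b b)
  ... | ()
  odd≢even (suc a) (suc b) p rewrite +-suc a a | +-suc b b = odd≢even a b (suc-injective (suc-injective p))

  double-injective : ∀ a b → a + a ≡ b + b → a ≡ b
  double-injective a b p = trans (sym (half-double a)) (trans (cong (_/ 2) p) (half-double b))

module SizeEquations where

  open import Data.Nat using () renaming (_+_ to _+ℕ_)
  open import Data.Integer using (ℤ; +_; _+_; _*_; _-_; 0ℤ; 1ℤ)
  import Data.Integer.Properties as ℤP
  open import Data.Integer.Tactic.RingSolver using (solve-∀)
  open import Data.Product using (_×_; _,_)
  open import Data.Sum using (inj₁; inj₂)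
  open import Data.Empty using (⊥-elim)
  open import Relation.Binary.PropositionalEquality
  open OddOrder using (odd≢even; double-injective)

  -- (x - y)(x - y + 1) = 0, and y = x + 1 is ruled out by x + y being even.
  sizes≡half : ∀ x y m → + x + + y ≡ + (m +ℕ m) →
               + x * + x + + y * + y + + x ≡ + x * + y + + y * + x + + y → x ≡ m × y ≡ m
  sizes≡half x y m x+y≡2m eq with ℤP.i*j≡0⇒i≡0∨j≡0 (+ x - + y) factorised
    where
    factorised : (+ x - + y) * (+ x - + y + 1ℤ) ≡ 0ℤ
    factorised = trans (expand (+ x) (+ y)) (trans (cong (_- (+ x * + y + + y * + x + + y)) eq) (ℤP.+-inverseʳ (+ x * + y + + y * + x + + y)))
      where
      expand : ∀ i j → (i - j) * (i - j + 1ℤ) ≡ i * i + j * j + i - (i * j + j * i + j)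
      expand = solve-∀
  ... | inj₁ x-y≡0 = x≡m , trans (sym x≡y) x≡m
    where
    x≡y : x ≡ y
    x≡y = ℤP.+-injective (ℤP.i-j≡0⇒i≡j _ _ x-y≡0)
    x≡m : x ≡ m
    x≡m = double-injective x m (ℤP.+-injective (trans (ℤP.pos-+ x x) (trans (cong (λ z → + x + + z) x≡y) x+y≡2m)))
  ... | inj₂ x-y+1≡0 = ⊥-elim (odd≢even x m (ℤP.+-injective
          (trans (sym (ℤP.pos-+ 1 (x +ℕ x)))
            (trans (cong (λ z → 1ℤ + z) (ℤP.pos-+ x x)) (trans (shift (+ x) (+ y) x-y+1≡0) x+y≡2m)))))
    where
    shift : ∀ i j → i - j + 1ℤ ≡ 0ℤ → 1ℤ + (i + i) ≡ i + j
    shift i j p = trans (rearrange i j) (trans (cong (λ z → i + j + z) p) (ℤP.+-identityʳ _))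
      where
      rearrange : ∀ i j → 1ℤ + (i + i) ≡ i + j + (i - j + 1ℤ)
      rearrange = solve-∀

module ExactlyOneOf where

  open import Data.Bool using (true; false)
  open import Data.Integer using (_+_; 1ℤ)
  open import Data.Sum using (_⊎_; inj₁; inj₂)
  open import Data.Empty using (⊥; ⊥-elim)
  open import Relation.Binary.PropositionalEquality
  open ListSum using (ι)

  data ExactlyOne : Bool → Bool → Bool → Set where
    first : ExactlyOne true false false
    second : ExactlyOne false true false
    third : ExactlyOne false false true

  exactlyOne : ∀ p q r → ι p + ι q + ι r ≡ 1ℤ → ExactlyOne p q r
  exactlyOne true false false _ = first
  exactlyOne false true false _ = second
  exactlyOne false false true _ = third
  exactlyOne true true true ()
  exactlyOne true true false ()
  exactlyOne true false true ()
  exactlyOne false true true ()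
  exactlyOne false false false ()

  ι-sum : ∀ {p q r} → ExactlyOne p q r → ι p + ι q + ι r ≡ 1ℤ
  ι-sum first = refl
  ι-sum second = refl
  ι-sum third = refl

  not-both : ∀ {p q r} → ExactlyOne p q r → p ≡ true → q ≡ true → ⊥
  not-both first _ ()
  not-both second ()
  not-both third ()

  one-of-first-two : ∀ {p q} → ExactlyOne p q false → p ≡ true ⊎ q ≡ true
  one-of-first-two first = inj₁ refl
  one-of-first-two second = inj₂ refl

  last-of-equal : ∀ {p r} → ExactlyOne p p r → r ≡ true
  last-of-equal third = refl

  from-first-two : ∀ {p q} → p ≡ true ⊎ q ≡ true → (p ≡ true → q ≡ true → ⊥) → ExactlyOne p q false
  from-first-two {true} {false} _ _ = first
  from-first-two {false} {true} _ _ = second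
  from-first-two {true} {true} _ both = ⊥-elim (both refl refl)
  from-first-two {false} {false} (inj₁ ()) _
  from-first-two {false} {false} (inj₂ ()) _

module CayleyDSRGCriterion (A : AbelianGroup 0ℓ 0ℓ)
  (≈⇒≡ : ∀ {x y : AbelianGroup.Carrier A} → AbelianGroup._≈_ A x y → x ≡ y)
  (_≟_ : DecidableEquality (AbelianGroup.Carrier A))
  (elems : List (AbelianGroup.Carrier A)) (uniq : Unique elems)
  (complete : ∀ x → x ∈ elems)
  {f : AbelianGroup.Carrier A → AbelianGroup.Carrier A}
  (hom : IsGroupHomomorphism (AbelianGroup.rawGroup A) (AbelianGroup.rawGroup A) f)
  (f-involutive : ∀ x → f (f x) ≡ x)
  {α : AbelianGroup.Carrier A} (fα≡α : f α ≡ α)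
  (X Y : AbelianGroup.Carrier A → Bool) (Xε≡false : X (AbelianGroup.ε A) ≡ false)
  {n μ lam : ℕ} (n≡length : n ≡ length elems)
  (n≡1+2μ : n ≡ Nat.suc (μ Nat.+ μ)) (1+lam≡μ : Nat.suc lam ≡ μ) where

  open import Data.Nat using (_∸_) renaming (_+_ to _+ℕ_; _*_ to _*ℕ_)
  import Data.Nat.Properties as ℕP
  open import Data.Integer using (ℤ; +_; _+_; _*_; _-_; 1ℤ)
  import Data.Integer.Properties as ℤP
  open import Data.Integer.Tactic.RingSolver using (solve-∀)
  open import Data.Bool using (true; if_then_else_)
  open import Data.Product using (_×_; _,_; proj₁; proj₂)
  import Data.Product.Properties as ProductProperties
  import Data.Bool.Properties as BoolProperties
  open import Data.Sum using (_⊎_; inj₁; inj₂; map₂)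
  open import Data.List using (map; _++_)
  import Data.List.Properties as ListProperties
  open import Data.List.Membership.Propositional.Properties using (∈-map⁺; ∈-map⁻; ∈-++⁺ˡ; ∈-++⁺ʳ)
  import Data.List.Relation.Unary.Unique.Propositional.Properties as UniqueProperties
  open import Data.Empty using (⊥-elim)
  open import Function using (const)
  open import Function.Bundles using (_⇔_; mk⇔; Equivalence)
  open import Function.Properties.Equivalence using () renaming (trans to ⇔-trans)
  open import Relation.Nullary using (¬_; yes; no; does)
  open import Relation.Binary.PropositionalEquality hiding ([_])
  open import Defs using (count; IsDSRG; module Construction)
  open AbelianGroup A using (Carrier; _∙_; ε; _⁻¹)
  open AbelianGroupLaws A ≈⇒≡
  open Endomorphism hom
  open ListSum
  open GroupRing A ≈⇒≡ _≟_ elems uniq complete hiding (solve)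
  open GroupRingAutomorphism A ≈⇒≡ _≟_ elems uniq complete hom f-involutive
  open GroupExtension A ≈⇒≡ hom f-involutive fα≡α using (e; isGroup)
  open Construction A f α
  open ExactlyOneOf
  open CommutativeMonoidSolver using (solve; _⊜_) renaming (_⊕_ to _⊞_)

  _≟G_ : DecidableEquality G
  _≟G_ = ProductProperties.≡-dec _≟_ BoolProperties._≟_

  uniqG : Unique (gElems elems)
  uniqG = UniqueProperties.++⁺ (UniqueProperties.map⁺ (cong proj₁) uniq) (UniqueProperties.map⁺ (cong proj₁) uniq) disjoint
    where
    disjoint : ∀ {v} → ¬ (v ∈ map (_, false) elems × v ∈ map (_, true) elems)
    disjoint (p , q) with ∈-map⁻ (_, false) p | ∈-map⁻ (_, true) q
    ... | (a , _ , refl) | (b , _ , ())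

  completeG : ∀ x → x ∈ gElems elems
  completeG (a , false) = ∈-++⁺ˡ (∈-map⁺ (_, false) (complete a))
  completeG (a , true) = ∈-++⁺ʳ (map (_, false) elems) (∈-map⁺ (_, true) (complete a))

  open CayleyGraph isGroup _≟G_ (gElems elems) uniqG completeG (conn X Y)

  ∑-G : ∀ (h : G → ℤ) → ∑ (gElems elems) h ≡ Σ (λ c → h (c , false)) + Σ (λ c → h (c , true))
  ∑-G h = trans (∑-++ (map (_, false) elems) _ h) (cong₂ _+_ (∑-map elems _ h) (∑-map elems _ h))

  xs ys : ZA
  xs a = ι (X a)
  ys a = ι (Y a)

  s²-A : ∀ w → s² (w , false) ≡ (xs ⋆ xs ⊕ [ α ] ⋆ (F ys ⋆ ys)) w
  s²-A w = trans (∑-G _) (cong₂ _+_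
    (∑-cong elems (λ c → cong (λ z → xs c * xs z) (comm w (c ⁻¹))))
    (sym (trans ([ α ]-⋆ (F ys ⋆ ys) w) (trans (F-⋆-at ys ys (α ⁻¹ ∙ w))
      (∑-cong elems (λ c → cong (λ z → ys c * ys z) (regroup c)))))))
    where
    regroup : ∀ c → f c ⁻¹ ∙ (α ⁻¹ ∙ w) ≡ w ∙ (α ⁻¹ ∙ f (c ⁻¹))
    regroup c = trans (≈⇒≡ (solve 3 (λ y a v → y ⊞ (a ⊞ v) ⊜ v ⊞ (a ⊞ y)) (AbelianGroup.refl A) (f c ⁻¹) (α ⁻¹) w))
                  (cong (λ z → w ∙ (α ⁻¹ ∙ z)) (sym (f-⁻¹ c)))

  s²-Aβ : ∀ w → s² (w , true) ≡ (F xs ⋆ ys ⊕ ys ⋆ xs) w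
  s²-Aβ w = trans (∑-G _) (cong₂ _+_
    (sym (trans (F-⋆-at xs ys w) (∑-cong elems (λ c → cong (λ z → xs c * ys z)
      (trans (comm _ w) (cong (w ∙_) (sym (f-⁻¹ c))))))))
    (∑-cong elems (λ c → cong (λ z → ys c * xs z) (regroup c))))
    where
    regroup : ∀ c → (w ∙ f (α ⁻¹ ∙ f (c ⁻¹))) ∙ α ≡ c ⁻¹ ∙ w
    regroup c = begin
        (w ∙ f (α ⁻¹ ∙ f (c ⁻¹))) ∙ α
      ≡⟨ cong (λ z → (w ∙ z) ∙ α) (trans (f-∙ _ _) (cong₂ _∙_ (trans (f-⁻¹ α) (cong _⁻¹ fα≡α)) (f-involutive (c ⁻¹)))) ⟩
        (w ∙ (α ⁻¹ ∙ c ⁻¹)) ∙ α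
      ≡⟨ ≈⇒≡ (solve 4 (λ v a c b → (v ⊞ (a ⊞ c)) ⊞ b ⊜ (a ⊞ b) ⊞ (c ⊞ v)) (AbelianGroup.refl A) w (α ⁻¹) (c ⁻¹) α) ⟩
        (α ⁻¹ ∙ α) ∙ (c ⁻¹ ∙ w)
      ≡⟨ trans (cong (_∙ (c ⁻¹ ∙ w)) (inverseˡ α)) (identityˡ _) ⟩
        c ⁻¹ ∙ w ∎
      where open ≡-Reasoning

  Equations : Set
  Equations = aug xs + aug ys ≡ + (μ +ℕ μ)
            × xs ⋆ xs ⊕ [ α ] ⋆ (F ys ⋆ ys) ⊕ xs ≐ const (+ μ)
            × F xs ⋆ ys ⊕ ys ⋆ xs ⊕ ys ≐ const (+ μ)

  isDSRG⇔Equations : IsDSRG (gElems elems) (cayArc (conn X Y)) (2 *ℕ n) (n ∸ 1) μ lam μ ⇔ Equations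
  isDSRG⇔Equations = ⇔-trans criterion (mk⇔ to from)
    where
    size : count (λ _ → true) (gElems elems) ≡ 2 *ℕ n
    size = begin
        count (λ _ → true) (gElems elems)
      ≡⟨ count-true (gElems elems) ⟩
        length (map (_, false) elems ++ map (_, true) elems)
      ≡⟨ ListProperties.length-++ (map (_, false) elems) ⟩
        length (map (_, false) elems) +ℕ length (map (_, true) elems)
      ≡⟨ cong₂ _+ℕ_ (ListProperties.length-map _ elems) (ListProperties.length-map _ elems) ⟩
        length elems +ℕ length elems
      ≡⟨ cong (λ m → m +ℕ m) (sym n≡length) ⟩
        n +ℕ n
      ≡⟨ cong (n +ℕ_) (sym (ℕP.+-identityʳ n)) ⟩
        2 *ℕ n ∎
      where open ≡-Reasoning
    criterion : IsDSRG (gElems elems) arc (2 *ℕ n) (n ∸ 1) μ lam μ ⇔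
                (∑ (gElems elems) s ≡ + (n ∸ 1) × (∀ g → s² g + s g ≡ + μ))
    criterion = isDSRG⇔ Xε≡false 1+lam≡μ size
    k≡2μ : + (n ∸ 1) ≡ + (μ +ℕ μ)
    k≡2μ = cong (λ m → + (m ∸ 1)) n≡1+2μ
    to : ∑ (gElems elems) s ≡ + (n ∸ 1) × (∀ g → s² g + s g ≡ + μ) → Equations
    to (Σs≡k , s²+s) = trans (sym (∑-G s)) (trans Σs≡k k≡2μ)
                     , (λ w → trans (cong (_+ xs w) (sym (s²-A w))) (s²+s (w , false)))
                     , (λ w → trans (cong (_+ ys w) (sym (s²-Aβ w))) (s²+s (w , true)))
    from : Equations → ∑ (gElems elems) s ≡ + (n ∸ 1) × (∀ g → s² g + s g ≡ + μ)
    from (size-sum , E₁ , E₂) = trans (∑-G s) (trans size-sum (sym k≡2μ)) , s²+s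
      where
      s²+s : ∀ g → s² g + s g ≡ + μ
      s²+s (w , false) = trans (cong (_+ xs w) (s²-A w)) (E₁ w)
      s²+s (w , true) = trans (cong (_+ ys w) (s²-Aβ w)) (E₂ w)

  Conditions : Set
  Conditions = (count X elems ≡ μ × count Y elems ≡ μ)
     × ((∀ a → ¬ (X a ≡ true × InImage X a))
        × (∀ a → (X a ≡ true ⊎ InImage X a) ⇔ (¬ (a ≡ ε))))
     × α ≡ ε
     × (∀ a → mulGA elems (bar X) (fGA elems _≟_ (bar X)) a
              ≡ mulGA elems (bar Y) (fGA elems _≟_ (bar Y)) a)

  Partition : Set
  Partition = xs ⊕ F xs ⊕ 𝟙 ≐ Ā

  ExactlyOneOfXfXe : Set
  ExactlyOneOfXfXe = ∀ a → ExactlyOne (X a) (X (f a)) (does (a ≟ ε))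

  partition⇔exactlyOne : Partition ⇔ ExactlyOneOfXfXe
  partition⇔exactlyOne = mk⇔ (λ P a → exactlyOne _ _ _ (P a)) (λ h a → ι-sum (h a))

  InImage⇔ : ∀ a → InImage X a ⇔ X (f a) ≡ true
  InImage⇔ a = mk⇔ (λ { (x , Xx , fx≡a) → trans (cong (λ z → X (f z)) (sym fx≡a)) (trans (cong X (f-involutive x)) Xx) })
                   (λ Xfa → f a , Xfa , f-involutive a)

  exactlyOne⇔disjoint×cover : ExactlyOneOfXfXe ⇔
    ((∀ a → ¬ (X a ≡ true × InImage X a)) × (∀ a → (X a ≡ true ⊎ InImage X a) ⇔ (¬ (a ≡ ε))))
  exactlyOne⇔disjoint×cover = mk⇔ (λ h → disjoint h , λ a → mk⇔ (excludes-ε a) (covered a (h a))) from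
    where
    disjoint : ExactlyOneOfXfXe → ∀ a → ¬ (X a ≡ true × InImage X a)
    disjoint h a (Xa , image) = not-both (h a) Xa (Equivalence.to (InImage⇔ a) image)
    excludes-ε : ∀ a → X a ≡ true ⊎ InImage X a → ¬ a ≡ ε
    excludes-ε a (inj₁ Xa) refl with trans (sym Xa) Xε≡false
    ... | ()
    excludes-ε a (inj₂ image) refl with trans (sym (Equivalence.to (InImage⇔ ε) image)) (trans (cong X f-ε) Xε≡false)
    ... | ()
    covered : ∀ a → ExactlyOne (X a) (X (f a)) (does (a ≟ ε)) → ¬ a ≡ ε → X a ≡ true ⊎ InImage X a
    covered a eo a≢ε with a ≟ ε
    ... | yes a≡ε = ⊥-elim (a≢ε a≡ε)
    ... | no _ = map₂ (Equivalence.from (InImage⇔ a)) (one-of-first-two eo)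
    from : (∀ a → ¬ (X a ≡ true × InImage X a)) × (∀ a → (X a ≡ true ⊎ InImage X a) ⇔ (¬ (a ≡ ε))) → ExactlyOneOfXfXe
    from (disjoint , cover) a with a ≟ ε
    ... | yes refl rewrite f-ε | Xε≡false = third
    ... | no a≢ε = from-first-two (map₂ (Equivalence.to (InImage⇔ a)) (Equivalence.from (cover a) a≢ε))
                                  (λ Xa Xfa → disjoint a (Xa , Equivalence.from (InImage⇔ a) Xfa))

  exactlyOne⇒α≡ε : ExactlyOneOfXfXe → α ≡ ε
  exactlyOne⇒α≡ε h with α ≟ ε | last-of-equal (subst (λ z → ExactlyOne (X α) (X z) (does (α ≟ ε))) fα≡α (h α))
  ... | yes α≡ε | _ = α≡ε
  ... | no _ | ()

  +bar : ∀ (Z : Carrier → Bool) b → + bar Z b ≡ ι (Z b)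
  +bar Z b with Z b
  ... | true = refl
  ... | false = refl

  +fGA-bar : ∀ (Z : Carrier → Bool) c → + fGA elems _≟_ (bar Z) c ≡ ι (Z (f c))
  +fGA-bar Z c = begin
      + fGA elems _≟_ (bar Z) c
    ≡⟨ pos-sum-map _ elems ⟩
      Σ (λ b → + (if does (f b ≟ c) then bar Z b else 0))
    ≡⟨ ∑-cong elems (λ b → trans (ι-if (does (f b ≟ c)) (bar Z b)) (cong (δ (f b) c *_) (+bar Z b))) ⟩
      Σ (λ b → δ (f b) c * ι (Z b))
    ≡⟨ ∑-cong elems (λ b → cong (λ z → δ (f b) c * ι (Z z)) (sym (f-involutive b))) ⟩
      Σ (λ b → δ (f b) c * ι (Z (f (f b))))
    ≡⟨ Σ-f (λ b → δ b c * ι (Z (f b))) ⟩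
      Σ (λ b → δ b c * ι (Z (f b)))
    ≡⟨ Σ-δˡ c (λ b → ι (Z (f b))) ⟩
      ι (Z (f c)) ∎
    where open ≡-Reasoning

  +mulGA-bar : ∀ (Z : Carrier → Bool) a →
               + mulGA elems (bar Z) (fGA elems _≟_ (bar Z)) a ≡ ((λ b → ι (Z b)) ⋆ F (λ b → ι (Z b))) a
  +mulGA-bar Z a = trans (pos-sum-map _ elems) (∑-cong elems (λ b →
    trans (ℤP.pos-* (bar Z b) (fGA elems _≟_ (bar Z) (b ⁻¹ ∙ a))) (cong₂ _*_ (+bar Z b) (+fGA-bar Z (b ⁻¹ ∙ a)))))

  products⇔ : (∀ a → mulGA elems (bar X) (fGA elems _≟_ (bar X)) a ≡ mulGA elems (bar Y) (fGA elems _≟_ (bar Y)) a)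
              ⇔ xs ⋆ F xs ≐ ys ⋆ F ys
  products⇔ = mk⇔ (λ eq a → trans (sym (+mulGA-bar X a)) (trans (cong +_ (eq a)) (+mulGA-bar Y a)))
                  (λ eq a → ℤP.+-injective (trans (+mulGA-bar X a) (trans (eq a) (sym (+mulGA-bar Y a)))))

  aug-xs : aug xs ≡ + count X elems
  aug-xs = sym (count≡∑ι X elems)

  aug-ys : aug ys ≡ + count Y elems
  aug-ys = sym (count≡∑ι Y elems)

  aug-Ā : aug Ā ≡ 1ℤ + + μ + + μ
  aug-Ā = begin
      aug Ā                 ≡⟨ sym (count≡∑ι (λ _ → true) elems) ⟩
      + count (λ _ → true) elems ≡⟨ cong +_ (trans (count-true elems) (trans (sym n≡length) n≡1+2μ)) ⟩
      1ℤ + + (μ +ℕ μ)       ≡⟨ cong (λ z → 1ℤ + z) (ℤP.pos-+ μ μ) ⟩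
      1ℤ + (+ μ + + μ)      ≡⟨ sym (ℤP.+-assoc 1ℤ (+ μ) (+ μ)) ⟩
      1ℤ + + μ + + μ        ∎
    where open ≡-Reasoning

  ⋆-partition : Partition → ∀ u → u ⋆ xs ⊕ u ⋆ F xs ⊕ u ≐ const (aug u)
  ⋆-partition P u w = begin
      (u ⋆ xs) w + (u ⋆ F xs) w + u w
    ≡⟨ sym (trans (⋆-distribˡ u (xs ⊕ F xs) 𝟙 w) (cong₂ _+_ (⋆-distribˡ u xs (F xs) w) (⋆-identityʳ u w))) ⟩
      (u ⋆ (xs ⊕ F xs ⊕ 𝟙)) w
    ≡⟨ ⋆-congʳ u P w ⟩
      (u ⋆ Ā) w
    ≡⟨ ⋆-Ā u w ⟩
      aug u ∎
    where open ≡-Reasoning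

  [ε]-⋆ : α ≡ ε → [ α ] ⋆ (F ys ⋆ ys) ≐ ys ⋆ F ys
  [ε]-⋆ refl w = trans (⋆-identityˡ (F ys ⋆ ys) w) (⋆-comm (F ys) ys w)

  equations⇒conditions : Equations → Conditions
  equations⇒conditions (size-sum , E₁ , E₂) =
    (X-size , Y-size) , Equivalence.to exactlyOne⇔disjoint×cover eo , exactlyOne⇒α≡ε eo , Equivalence.from products⇔ products
    where
    open ≡-Reasoning
    aug-E₁ : aug xs * aug xs + aug ys * aug ys + aug xs ≡ + μ * aug Ā
    aug-E₁ = begin
        aug xs * aug xs + aug ys * aug ys + aug xs
      ≡⟨ cong₂ (λ p q → p + q + aug xs) (sym (aug-⋆ xs xs)) (sym aug-twisted) ⟩
        aug (xs ⋆ xs) + aug ([ α ] ⋆ (F ys ⋆ ys)) + aug xs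
      ≡⟨ sym (trans (aug-⊕ _ xs) (cong (_+ aug xs) (aug-⊕ (xs ⋆ xs) _))) ⟩
        aug (xs ⋆ xs ⊕ [ α ] ⋆ (F ys ⋆ ys) ⊕ xs)
      ≡⟨ aug-const (+ μ) E₁ ⟩
        + μ * aug Ā ∎
      where
      aug-twisted : aug ([ α ] ⋆ (F ys ⋆ ys)) ≡ aug ys * aug ys
      aug-twisted = trans (aug-⋆ [ α ] _) (trans (cong₂ _*_ (aug-[] α) (trans (aug-⋆ (F ys) ys) (cong (_* aug ys) (aug-F ys))))
                      (ℤP.*-identityˡ _))
    aug-E₂ : aug xs * aug ys + aug ys * aug xs + aug ys ≡ + μ * aug Ā
    aug-E₂ = begin
        aug xs * aug ys + aug ys * aug xs + aug ys
      ≡⟨ cong₂ (λ p q → p + q + aug ys) (sym (trans (aug-⋆ (F xs) ys) (cong (_* aug ys) (aug-F xs)))) (sym (aug-⋆ ys xs)) ⟩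
        aug (F xs ⋆ ys) + aug (ys ⋆ xs) + aug ys
      ≡⟨ sym (trans (aug-⊕ _ ys) (cong (_+ aug ys) (aug-⊕ (F xs ⋆ ys) _))) ⟩
        aug (F xs ⋆ ys ⊕ ys ⋆ xs ⊕ ys)
      ≡⟨ aug-const (+ μ) E₂ ⟩
        + μ * aug Ā ∎
    sizes : count X elems ≡ μ × count Y elems ≡ μ
    sizes = SizeEquations.sizes≡half (count X elems) (count Y elems) μ
      (subst₂ (λ x y → x + y ≡ + (μ +ℕ μ)) aug-xs aug-ys size-sum)
      (subst₂ (λ x y → x * x + y * y + x ≡ x * y + y * x + y) aug-xs aug-ys (trans aug-E₁ (sym aug-E₂)))
    X-size : count X elems ≡ μ
    X-size = proj₁ sizes
    Y-size : count Y elems ≡ μ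
    Y-size = proj₂ sizes
    partition : Partition
    partition = X⊕FX⊕𝟙≐Ā fα≡α xs ys (+ μ) aug-Ā (trans aug-xs (cong +_ X-size)) (trans aug-ys (cong +_ Y-size)) E₁ E₂
    eo : ExactlyOneOfXfXe
    eo = Equivalence.to partition⇔exactlyOne partition
    products : xs ⋆ F xs ≐ ys ⋆ F ys
    products w = trans (cancel-middle ((xs ⋆ xs) w) ((xs ⋆ F xs) w) (([ α ] ⋆ (F ys ⋆ ys)) w) (xs w)
                          (trans (⋆-partition partition xs w) (trans aug-xs (cong +_ X-size))) (E₁ w))
                       ([ε]-⋆ (exactlyOne⇒α≡ε eo) w)
      where
      cancel-middle : ∀ p q q' r {m} → p + q + r ≡ m → p + q' + r ≡ m → q ≡ q'
      cancel-middle p q q' r e e' = trans (shift p q r) (trans (cong (λ z → z - p - r) (trans e (sym e'))) (sym (shift p q' r)))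
        where
        shift : ∀ p q r → q ≡ p + q + r - p - r
        shift = solve-∀

  conditions⇒equations : Conditions → Equations
  conditions⇒equations ((X-size , Y-size) , disjoint×cover , α≡ε , products-eq) = size-sum , E₁ , E₂
    where
    augX : aug xs ≡ + μ
    augX = trans aug-xs (cong +_ X-size)
    augY : aug ys ≡ + μ
    augY = trans aug-ys (cong +_ Y-size)
    size-sum : aug xs + aug ys ≡ + (μ +ℕ μ)
    size-sum = trans (cong₂ _+_ augX augY) (sym (ℤP.pos-+ μ μ))
    partition : Partition
    partition = Equivalence.from partition⇔exactlyOne (Equivalence.from exactlyOne⇔disjoint×cover disjoint×cover)
    products : xs ⋆ F xs ≐ ys ⋆ F ys
    products = Equivalence.to products⇔ products-eq
    E₁ : xs ⋆ xs ⊕ [ α ] ⋆ (F ys ⋆ ys) ⊕ xs ≐ const (+ μ)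
    E₁ w = trans (cong (λ z → (xs ⋆ xs) w + z + xs w) (trans ([ε]-⋆ α≡ε w) (sym (products w))))
                 (trans (⋆-partition partition xs w) augX)
    E₂ : F xs ⋆ ys ⊕ ys ⋆ xs ⊕ ys ≐ const (+ μ)
    E₂ w = trans (cong (_+ ys w) (trans (cong (_+ (ys ⋆ xs) w) (⋆-comm (F xs) ys w)) (ℤP.+-comm ((ys ⋆ F xs) w) ((ys ⋆ xs) w))))
                 (trans (⋆-partition partition ys w) augY)

  isDSRG⇔Conditions : IsDSRG (gElems elems) (cayArc (conn X Y)) (2 *ℕ n) (n ∸ 1) μ lam μ ⇔ Conditions
  isDSRG⇔Conditions = ⇔-trans isDSRG⇔Equations (mk⇔ equations⇒conditions conditions⇒equations)

open import Defs using (count; IsDSRG; module Construction)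
open import Data.Nat using (suc; _+_; _≤_; _∸_; _*_; _/_; _%_)
open import Data.Bool using (true)
open import Data.Product using (_×_; ∃; proj₁; proj₂)
open import Data.Sum using (_⊎_)
open import Relation.Nullary using (¬_)
open import Function.Bundles using (_⇔_)
open import Algebra.Morphism.Structures using (IsGroupIsomorphism)

theorem3 : (A : AbelianGroup 0ℓ 0ℓ) →
  let open AbelianGroup A in
  (∀ {x y} → x ≈ y → x ≡ y) →
  (_≟_ : DecidableEquality Carrier) →
  (elems : List Carrier) → Unique elems → (∀ x → x ∈ elems) →
  (n : ℕ) → n ≡ length elems → 3 ≤ n → n % 2 ≡ 1 →
  (α : Carrier) (f : Carrier → Carrier) →
  IsGroupIsomorphism rawGroup rawGroup f →
  (∀ x → f (f x) ≡ x) → (∃ λ x → ¬ (f x ≡ x)) →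
  f α ≡ α →
  (X Y : Carrier → Bool) → X ε ≡ false →
  let open Construction A f α in
  IsDSRG (gElems elems) (cayArc (conn X Y))
    (2 * n) (n ∸ 1) ((n ∸ 1) / 2) ((n ∸ 3) / 2) ((n ∸ 1) / 2)
  ⇔
  ((count X elems ≡ (n ∸ 1) / 2 × count Y elems ≡ (n ∸ 1) / 2)
   × ((∀ a → ¬ (X a ≡ true × InImage X a))
      × (∀ a → (X a ≡ true ⊎ InImage X a) ⇔ (¬ (a ≡ ε))))
   × α ≡ ε
   × (∀ a → mulGA elems (bar X) (fGA elems _≟_ (bar X)) a
            ≡ mulGA elems (bar Y) (fGA elems _≟_ (bar Y)) a))
theorem3 A ≈⇒≡ _≟_ elems uniq complete n n≡length 3≤n n-odd α f iso f-involutive _ fα≡α X Y Xε≡false =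
  CayleyDSRGCriterion.isDSRG⇔Conditions A ≈⇒≡ _≟_ elems uniq complete
    (IsGroupIsomorphism.isGroupHomomorphism iso) f-involutive fα≡α X Y Xε≡false
    n≡length (proj₁ parameters) (proj₂ parameters)
  where
  parameters : n ≡ suc ((n ∸ 1) / 2 + (n ∸ 1) / 2) × suc ((n ∸ 3) / 2) ≡ (n ∸ 1) / 2
  parameters = OddOrder.odd-parameters n 3≤n n-odd
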